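{- Let $n\ge 1$ and let $\mathcal{D}$ be a probability distribution over $S_n$. The following five statements are equivalent: (i) $\mathcal{D}$ is backwards $1$-uniform. (ii) $\mathcal{D}$ is backwards $1$-efficient. (iii) $\mathcal{D}$ is exact minwise. (iv) $\mathcal{D}$ is exact maxwise. (v) The transition graph of $\mathcal{D}$ equals the transition graph of the uniform distribution on $S_n$; equivalently, for every nonempty $S\subseteq[n]$ we have $\Pr_{\pi\sim\mathcal{D}}[\pi([|S|])=S]=1/\binom{n}{|S|}$, and for every $s\in S$ we have $\Pr_{\pi\sim\mathcal{D}}[\pi(|S|)=s\mid \pi([|S|])=S]=1/|S|$.
   Context: $[n]=\{1,\dots,n\}$ and $S_n$ is the set of permutations of $[n]$. A permutation $\pi\in S_n$ is viewed as an ordering $(\pi(1),\dots,\pi(n))$ of $[n]$: $\pi(i)$ is the $i$-th element. For $I\subseteq[n]$, $\pi(I)=\{\pi(j): j\in I\}$, and $[i]=\{1,\dots,i\}$. A cost function over $[n]$ assigns a real number $c(x,Y)$ to every $Y\subseteq[n]$ and $x\in Y$; the total cost of $\pi$ is $c(\pi)=\sum_{i=1}^n c(\pi(i),\pi([i]))$. $\mathcal{D}$ is backwards $\alpha$-uniform if for every $Y\subseteq[n]$ with $\Pr_{\pi\sim\mathcal{D}}[\pi([|Y|])=Y]>0$ and every $x\in Y$, $\Pr_{\pi\sim\mathcal{D}}[\pi(|Y|)=x\mid\pi([|Y|])=Y]\le\alpha/|Y|$. $\mathcal{D}$ is backwards $\alpha$-efficient if for every cost function $c$ such that $\mathbb{E}_{x\sim\mathcal{U}(Y)}[c(x,Y)]\le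 1$ for every nonempty $Y\subseteq[n]$ (where $\mathcal{U}(Y)$ is the uniform distribution on $Y$), we have $\mathbb{E}_{\pi\sim\mathcal{D}}[c(\pi)]\le\alpha n$. $\mathcal{D}$ is exact minwise if for every nonempty $Y\subseteq[n]$ and every $x\in Y$, the probability (over $\pi\sim\mathcal{D}$) that $x$ is the first element of $Y$ to occur in the sequence $\pi(1),\pi(2),\dots,\pi(n)$ equals $1/|Y|$; it is exact maxwise if the same holds with "first" replaced by "last". The transition graph of $\mathcal{D}$ has a node for every $S\subseteq[n]$ with weight $w(S)=\Pr_{\pi\sim\mathcal{D}}[\pi([|S|])=S]$, and for every nonempty $S$ with $w(S)>0$ and every $s\in S$ an edge $(S,S\setminus\{s\})$ with weight $\Pr_{\pi\sim\mathcal{D}}[\pi(|S|)=s\mid\pi([|S|])=S]$.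
   Formalization: The distribution $\mathcal{D}$ has rational probabilities, and the cost functions in the definition of backwards $1$-efficient take rational values rather than real ones. -}

module Defs where

open import Data.Bool using (Bool; true; false; if_then_else_; not; _∨_; _∧_)
import Data.Bool.Properties as BoolP
open import Data.Nat as ℕ using (ℕ; zero; suc; _≡ᵇ_; _<ᵇ_; _≤ᵇ_)
open import Data.Nat.Combinatorics using (_C_)
open import Data.Integer using (+_)
open import Data.Rational using (ℚ; 0ℚ; 1ℚ; _+_; _*_; _≤_; _<_; _/_)
open import Data.Fin using (Fin; toℕ)
open import Data.Fin.Subset using (Subset; _∈_; Nonempty; ∣_∣)
open import Data.Fin.Permutation using (Permutation′; _⟨$⟩ʳ_; _⟨$⟩ˡ_)
open import Data.List using (List; map; foldr; allFin)
open import Data.List.Relation.Unary.All using (All)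
open import Data.Vec using (tabulate; lookup)
open import Data.Vec.Properties using (≡-dec)
open import Data.Product using (_×_; _,_; proj₁; proj₂)
open import Relation.Nullary using (does)
open import Relation.Binary.PropositionalEquality using (_≡_)

ℕtoℚ : ℕ → ℚ
ℕtoℚ k = (+ k) / 1

sumℚ : List ℚ → ℚ
sumℚ = foldr _+_ 0ℚ

-- Positions are 0-indexed: π(i) (1-indexed) is  π ⟨$⟩ʳ (i-1),
-- and the (0-indexed) position of element x is  π ⟨$⟩ˡ x.
pos : ∀ {n} → Permutation′ n → Fin n → ℕ
pos π x = toℕ (π ⟨$⟩ˡ x)

-- π([k]) = { π(1), …, π(k) } = the set of elements at 0-indexed position < k
prefixSet : ∀ {n} → ℕ → Permutation′ n → Subset n
prefixSet k π = tabulate (λ y → pos π y <ᵇ k)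

record Dist (n : ℕ) : Set where
  field
    support : List (ℚ × Permutation′ n)
    nonneg  : All (λ p → 0ℚ ≤ proj₁ p) support
    total   : sumℚ (map proj₁ support) ≡ 1ℚ
open Dist public

Event : ℕ → Set
Event n = Permutation′ n → Bool

Pr : ∀ {n} → Dist n → Event n → ℚ
Pr D E = sumℚ (map (λ p → if E (proj₂ p) then proj₁ p else 0ℚ) (support D))

Exp : ∀ {n} → Dist n → (Permutation′ n → ℚ) → ℚ
Exp D f = sumℚ (map (λ p → proj₁ p * f (proj₂ p)) (support D))

allB : ∀ {A : Set} → (A → Bool) → List A → Bool
allB p = foldr (λ a b → p a ∧ b) true

prefixIs : ∀ {n} → Subset n → Event n
prefixIs Y π = does (≡-dec BoolP._≟_ (prefixSet ∣ Y ∣ π) Y)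

-- π(|Y|) = x   (1-indexed position |Y|)
lastIs : ∀ {n} → Subset n → Fin n → Event n
lastIs Y x π = suc (pos π x) ≡ᵇ ∣ Y ∣

-- x is the first (resp. last) element of Y in π(1),…,π(n)  (x ∈ Y assumed)
firstOf : ∀ {n} → Subset n → Fin n → Event n
firstOf {n} Y x π = allB (λ y → not (lookup Y y) ∨ (pos π x ≤ᵇ pos π y)) (allFin n)

lastOf : ∀ {n} → Subset n → Fin n → Event n
lastOf {n} Y x π = allB (λ y → not (lookup Y y) ∨ (pos π y ≤ᵇ pos π x)) (allFin n)

_∧ᴱ_ : ∀ {n} → Event n → Event n → Event n
(A ∧ᴱ B) π = A π ∧ B π

-- Pr[A | B], for Pr[B] > 0, is Pr[A ∧ B] / Pr[B]; the bound
-- Pr[A | B] ≤ q is stated in the equivalent form Pr[A ∧ B] ≤ q * Pr[B].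

BackwardsUniform : ∀ {n} → ℚ → Dist n → Set
BackwardsUniform {n} α D =
  (Y : Subset n) → 0ℚ < Pr D (prefixIs Y) → (x : Fin n) → x ∈ Y →
  ℕtoℚ ∣ Y ∣ * Pr D (lastIs Y x ∧ᴱ prefixIs Y) ≤ α * Pr D (prefixIs Y)

-- cost functions: c x Y (only values with x ∈ Y are relevant)
CostFn : ℕ → Set
CostFn n = Fin n → Subset n → ℚ

sumOver : ∀ {n} → Subset n → (Fin n → ℚ) → ℚ
sumOver {n} Y f = sumℚ (map (λ x → if lookup Y x then f x else 0ℚ) (allFin n))

totalCost : ∀ {n} → CostFn n → Permutation′ n → ℚ
totalCost {n} c π =
  sumℚ (map (λ k → c (π ⟨$⟩ʳ k) (prefixSet (suc (toℕ k)) π)) (allFin n))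

-- E_{x∼U(Y)}[c(x,Y)] ≤ 1, i.e. (1/|Y|) Σ_{x∈Y} c(x,Y) ≤ 1, stated as
-- Σ_{x∈Y} c(x,Y) ≤ |Y| (Y nonempty so |Y| > 0).
Admissible : ∀ {n} → CostFn n → Set
Admissible {n} c =
  (Y : Subset n) → Nonempty Y → sumOver Y (λ x → c x Y) ≤ ℕtoℚ ∣ Y ∣

BackwardsEfficient : ∀ {n} → ℚ → Dist n → Set
BackwardsEfficient {n} α D =
  (c : CostFn n) → Admissible c → Exp D (totalCost c) ≤ α * ℕtoℚ n

-- exact minwise / maxwise: Pr[x first of Y] = 1/|Y|, i.e. |Y| * Pr = 1
ExactMinwise : ∀ {n} → Dist n → Set
ExactMinwise {n} D =
  (Y : Subset n) → Nonempty Y → (x : Fin n) → x ∈ Y →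
  ℕtoℚ ∣ Y ∣ * Pr D (firstOf Y x) ≡ 1ℚ

ExactMaxwise : ∀ {n} → Dist n → Set
ExactMaxwise {n} D =
  (Y : Subset n) → Nonempty Y → (x : Fin n) → x ∈ Y →
  ℕtoℚ ∣ Y ∣ * Pr D (lastOf Y x) ≡ 1ℚ

-- (v): transition graph equals that of the uniform distribution, in the
-- paper's explicit form: for nonempty S, Pr[π([|S|]) = S] = 1 / C(n,|S|),
-- and for s ∈ S, Pr[π(|S|) = s | π([|S|]) = S] = 1/|S|.
UniformTransitionGraph : ∀ {n} → Dist n → Set
UniformTransitionGraph {n} D =
  (S : Subset n) → Nonempty S →
    (ℕtoℚ (n C ∣ S ∣) * Pr D (prefixIs S) ≡ 1ℚ)
  × ((s : Fin n) → s ∈ S →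
      ℕtoℚ ∣ S ∣ * Pr D (lastIs S s ∧ᴱ prefixIs S) ≡ Pr D (prefixIs S))

{-# OPTIONS --safe #-}
module Submission where

-- Everything is read off the transition graph. Write w(S) = Pr[π([|S|]) = S] and
-- F(S,x) = Pr[π([|S|]) = S ∧ π(|S|) = x] for the flow along the edge (S, S ∖ {x}). Every permutation
-- removes each x along exactly one edge, out of the set of elements up to x; hence
-- w(S) = Σ_{x∈S} F(S,x) = Σ_{x∉S} F(S ∪ {x}, x), the expected cost is Σ_S Σ_{x∈S} c(x,S) F(S,x),
-- Pr[x last in Y] = Σ_{S ⊇ Y} F(S,x) and Pr[x first in Y] = Σ_{x ∈ S ⊆ ∁Y ∪ {x}} F(S,x).
-- All five conditions say that F(S,·) is constant on S. Backwards 1-uniformity bounds the |S| flows out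
-- of S by w(S)/|S| while they sum to w(S). A balanced flow keeps the expected cost of an admissible c at
-- most n, and a cost concentrated on a single edge gives the converse. The maxwise and minwise
-- probabilities are triangular systems in F (over supersets, resp. over subsets ordered by size), so
-- prescribing them forces balance, while balance makes them depend on |Y| only. Finally, descending
-- induction on |S| with (n - k) C(n,k) = (k + 1) C(n,k+1) turns balance into w(S) = 1/C(n,|S|).

open import Defs
open import Data.Nat using (ℕ; _≤_; zero; suc)
open import Data.Rational using (1ℚ)
open import Data.Product using (_×_; _,_; proj₁; proj₂)
open import Function.Bundles using (_⇔_; mk⇔; module Equivalence)
open Equivalence using (to; from)

open import Algebra.Bundles using (CommutativeMonoid)
import Algebra.Properties.CommutativeMonoid.Sum as MonoidSum
open import Data.Bool using (Bool; true; false; not; _∧_; if_then_else_; T)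
import Data.Bool.Properties as BoolP
open import Data.Fin as Fin using (Fin; zero; suc; toℕ)
open import Data.Fin.Permutation using (Permutation′; _⟨$⟩ʳ_; _⟨$⟩ˡ_)
import Data.Fin.Permutation as Perm
import Data.Fin.Properties as FinP
open import Data.Fin.Subset using (Subset; inside; outside; _∈_; _∉_; _⊆_; _⊂_; ∣_∣; ⁅_⁆; _∪_; ∁)
open import Data.Fin.Subset.Induction using (⊃-wellFounded)
import Data.Fin.Subset.Properties as SubsetP
open SubsetP using (_∈?_; _⊆?_)
import Data.Integer as ℤ
import Data.Integer.Properties as ℤP
open import Data.List as List using (List; []; _∷_; _++_; allFin)
open import Data.List.Extrema.Nat using (argmax; argmin; argmax-all; argmin-all; f[xs]≤f[argmax]; f[argmin]≤f[xs])
open import Data.List.Membership.Propositional using () renaming (_∈_ to _∈ₗ_)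
open import Data.List.Membership.Propositional.Properties using (∈-allFin; ∈-filter⁺)
import Data.List.Properties as ListP
open import Data.List.Relation.Unary.All using (All) renaming ([] to []ᴬ; _∷_ to _∷ᴬ_)
import Data.List.Relation.Unary.All as All
open import Data.List.Relation.Unary.All.Properties using (all-filter)
open import Data.List.Relation.Unary.Any using (here; there)
import Data.Nat as ℕ
open import Data.Nat.Combinatorics using (_C_; nC1≡n; nCn≡1) renaming (nCk+nC[k+1]≡[n+1]C[k+1] to pascal)
import Data.Nat.Coprimality as Coprime
open import Data.Nat.Induction using (<-wellFounded)
import Data.Nat.Properties as ℕP
open import Data.Rational as ℚ using (ℚ; mkℚ; 0ℚ; _+_; _*_; 1/_; Positive) renaming (_≤_ to _≤ℚ_)
import Data.Rational.Properties as ℚP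
open import Data.Sum as Sum using (_⊎_; inj₁; inj₂)
open import Data.Unit using (tt)
open import Data.Vec using ([]; _∷_; here; there; lookup)
import Data.Vec.Properties as VecP
open import Function.Base using (_∘_; id)
open import Induction.WellFounded using (module All)
open import Level using (0ℓ)
open import Relation.Binary.Definitions using (DecidableEquality; tri<; tri≈; tri>)
import Relation.Binary.Construct.On as On
open import Relation.Binary.PropositionalEquality
open import Relation.Nullary using (¬_; Dec; yes; no; does; contradiction)
open import Relation.Nullary.Decidable using (T?; _×-dec_; _→-dec_; does-⇔; dec-true; dec-false)
import Relation.Nullary.Decidable as Dec

open import Algebra.Properties.CommutativeSemigroup
  (CommutativeMonoid.commutativeSemigroup ℚP.+-0-commutativeMonoid)
  using () renaming (interchange to +-interchange; xy∙z≈zy∙x to [x+y]+z≡[z+y]+x)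
open import Algebra.Properties.CommutativeSemigroup
  (CommutativeMonoid.commutativeSemigroup ℚP.*-1-commutativeMonoid)
  using () renaming (x∙yz≈y∙xz to x*[y*z]≡y*[x*z])
open import Algebra.Properties.Group ℚP.+-0-group using () renaming (∙-cancelˡ to +-cancelˡ)

ℕtoℚ≡mkℚ : ∀ k → ℕtoℚ k ≡ mkℚ (ℤ.+ k) 0 (Coprime.sym (Coprime.1-coprimeTo k))
ℕtoℚ≡mkℚ k = ℚP.normalize-coprime _

ℕtoℚ-+ : ∀ a b → ℕtoℚ (a ℕ.+ b) ≡ ℕtoℚ a + ℕtoℚ b
ℕtoℚ-+ a b = trans (ℚP./-cong numerators refl) (sym (cong₂ _+_ (ℕtoℚ≡mkℚ a) (ℕtoℚ≡mkℚ b)))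
  where
  numerators : ℤ.+ (a ℕ.+ b) ≡ ℤ.+ a ℤ.* ℤ.+ 1 ℤ.+ ℤ.+ b ℤ.* ℤ.+ 1
  numerators = trans (ℤP.pos-+ a b) (sym (cong₂ ℤ._+_ (ℤP.*-identityʳ (ℤ.+ a)) (ℤP.*-identityʳ (ℤ.+ b))))

ℕtoℚ-* : ∀ a b → ℕtoℚ (a ℕ.* b) ≡ ℕtoℚ a * ℕtoℚ b
ℕtoℚ-* a b = trans (ℚP./-cong (ℤP.pos-* a b) refl) (sym (cong₂ _*_ (ℕtoℚ≡mkℚ a) (ℕtoℚ≡mkℚ b)))

ℕtoℚ-injective : ∀ {a b} → ℕtoℚ a ≡ ℕtoℚ b → a ≡ b
ℕtoℚ-injective {a} {b} e =
  ℤP.+-injective (cong ℚ.numerator (trans (sym (ℕtoℚ≡mkℚ a)) (trans e (ℕtoℚ≡mkℚ b))))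

ℕtoℚ-suc-positive : ∀ m → Positive (ℕtoℚ (suc m))
ℕtoℚ-suc-positive m = ℚP.normalize-pos (suc m) 1

ℕtoℚ-*-cancelˡ : ∀ {k p q} → 0 ℕ.< k → ℕtoℚ k * p ≡ ℕtoℚ k * q → p ≡ q
ℕtoℚ-*-cancelˡ {suc m} _ e = ℚP.≤-antisym (cancel (ℚP.≤-reflexive e)) (cancel (ℚP.≤-reflexive (sym e)))
  where
  cancel : ∀ {x y} → ℕtoℚ (suc m) * x ≤ℚ ℕtoℚ (suc m) * y → x ≤ℚ y
  cancel = ℚP.*-cancelˡ-≤-pos (ℕtoℚ (suc m)) {{ℕtoℚ-suc-positive m}}

-- 1/ℕ 0 = 0 is a junk value.
1/ℕ : ℕ → ℚ
1/ℕ zero    = 0ℚ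
1/ℕ (suc m) = (1/ ℕtoℚ (suc m)) {{ℚP.pos⇒nonZero (ℕtoℚ (suc m)) {{ℕtoℚ-suc-positive m}}}}

*≡1⇒≡1/ℕ : ∀ m {q} → ℕtoℚ m * q ≡ 1ℚ → q ≡ 1/ℕ m
*≡1⇒≡1/ℕ zero    {q} e = contradiction (trans (sym (ℚP.*-zeroˡ q)) e) λ ()
*≡1⇒≡1/ℕ (suc m) {q} e = ℕtoℚ-*-cancelˡ {suc m} (ℕ.s≤s ℕ.z≤n)
  (trans e (sym (ℚP.*-inverseʳ (ℕtoℚ (suc m)) {{ℚP.pos⇒nonZero (ℕtoℚ (suc m)) {{ℕtoℚ-suc-positive m}}}})))

+-cancelˡ-≤ : ∀ a {b c} → a + b ≤ℚ a + c → b ≤ℚ c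
+-cancelˡ-≤ a {b} {c} le with ℚP.<-cmp b c
... | tri< b<c _ _ = ℚP.<⇒≤ b<c
... | tri≈ _ refl _ = ℚP.≤-refl
... | tri> _ _ c<b =
  contradiction (ℚP.<-≤-trans (ℚP.+-mono-≤-< (ℚP.≤-refl {a}) c<b) le) (ℚP.<-irrefl refl)

+-≤-≡⇒≡ : ∀ {a b c d} → a ≤ℚ b → c ≤ℚ d → a + c ≡ b + d → a ≡ b × c ≡ d
+-≤-≡⇒≡ {a} {b} {c} {d} a≤b c≤d e with ℚP.<-cmp a b
... | tri< a<b _ _ = contradiction e (ℚP.<⇒≢ (ℚP.+-mono-<-≤ a<b c≤d))
... | tri≈ _ refl _ = refl , +-cancelˡ a c d e
... | tri> _ _ b<a = contradiction (ℚP.≤-<-trans a≤b b<a) (ℚP.<-irrefl refl)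

-- Binomial coefficients

absorption : ∀ n k → suc k ℕ.* (suc n C suc k) ≡ suc n ℕ.* (n C k)
absorption zero    zero    = refl
absorption zero    (suc k) = ℕP.*-zeroʳ (suc (suc k))
absorption (suc n) zero    =
  trans (ℕP.+-identityʳ (suc (suc n) C 1)) (trans (nC1≡n (suc (suc n))) (sym (ℕP.*-identityʳ (suc (suc n)))))
absorption (suc n) (suc k) = begin
  suc (suc k) ℕ.* (suc (suc n) C suc (suc k))  ≡⟨ cong (suc (suc k) ℕ.*_) (sym (pascal (suc n) (suc k))) ⟩
  suc (suc k) ℕ.* (a ℕ.+ b)                    ≡⟨ ℕP.*-distribˡ-+ (suc (suc k)) a b ⟩
  a ℕ.+ suc k ℕ.* a ℕ.+ suc (suc k) ℕ.* b      ≡⟨ cong₂ (λ p q → a ℕ.+ p ℕ.+ q) (absorption n k)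
                                                                                  (absorption n (suc k)) ⟩
  a ℕ.+ suc n ℕ.* c ℕ.+ suc n ℕ.* e            ≡⟨ ℕP.+-assoc a (suc n ℕ.* c) (suc n ℕ.* e) ⟩
  a ℕ.+ (suc n ℕ.* c ℕ.+ suc n ℕ.* e)          ≡⟨ cong (a ℕ.+_) (sym (ℕP.*-distribˡ-+ (suc n) c e)) ⟩
  a ℕ.+ suc n ℕ.* (c ℕ.+ e)                    ≡⟨ cong (λ t → a ℕ.+ suc n ℕ.* t) (pascal n k) ⟩
  suc (suc n) ℕ.* a                            ∎
  where
  open ≡-Reasoning
  a = suc n C suc k
  b = suc n C suc (suc k)
  c = n C k
  e = n C suc k

-- (n - k) C(n,k) = (k+1) C(n,k+1), written with n = k + (d + 1) to avoid truncated subtraction.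
binomial-step : ∀ k d → suc d ℕ.* ((k ℕ.+ suc d) C k) ≡ suc k ℕ.* ((k ℕ.+ suc d) C suc k)
binomial-step zero    d = trans (ℕP.*-identityʳ (suc d)) (sym (trans (ℕP.+-identityʳ (suc d C 1)) (nC1≡n (suc d))))
binomial-step (suc k) d =
  trans (ℕP.+-cancelʳ-≡ (suc k ℕ.* c) (suc d ℕ.* c) (suc n ℕ.* e) sums) (sym (absorption n (suc k)))
  where
  open ≡-Reasoning
  n = k ℕ.+ suc d
  c = suc n C suc k
  e = n C suc k
  sums : suc d ℕ.* c ℕ.+ suc k ℕ.* c ≡ suc n ℕ.* e ℕ.+ suc k ℕ.* c
  sums = begin
    suc d ℕ.* c ℕ.+ suc k ℕ.* c           ≡⟨ sym (ℕP.*-distribʳ-+ c (suc d) (suc k)) ⟩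
    (suc d ℕ.+ suc k) ℕ.* c               ≡⟨ cong (ℕ._* c) (ℕP.+-comm (suc d) (suc k)) ⟩
    suc n ℕ.* c                           ≡⟨ cong (suc n ℕ.*_) (sym (pascal n k)) ⟩
    suc n ℕ.* (n C k ℕ.+ e)               ≡⟨ ℕP.*-distribˡ-+ (suc n) (n C k) e ⟩
    suc n ℕ.* (n C k) ℕ.+ suc n ℕ.* e     ≡⟨ ℕP.+-comm (suc n ℕ.* (n C k)) (suc n ℕ.* e) ⟩
    suc n ℕ.* e ℕ.+ suc n ℕ.* (n C k)     ≡⟨ cong (suc n ℕ.* e ℕ.+_) (sym (absorption n k)) ⟩
    suc n ℕ.* e ℕ.+ suc k ℕ.* c           ∎

[n∸k]*nCk≡[k+1]*nC[k+1] : ∀ {n k} → k ℕ.< n → (n ℕ.∸ k) ℕ.* (n C k) ≡ suc k ℕ.* (n C suc k)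
[n∸k]*nCk≡[k+1]*nC[k+1] {n} {k} k<n =
  subst (λ m → (m ℕ.∸ k) ℕ.* (m C k) ≡ suc k ℕ.* (m C suc k)) k+1+d≡n
        (trans (cong (ℕ._* ((k ℕ.+ suc d) C k)) (ℕP.m+n∸m≡n k (suc d))) (binomial-step k d))
  where
  d = n ℕ.∸ suc k
  k+1+d≡n : k ℕ.+ suc d ≡ n
  k+1+d≡n = trans (ℕP.+-suc k d) (ℕP.m+[n∸m]≡n k<n)

-- Definitionally the guarded terms `if b then q else 0ℚ` of Pr and sumOver.
_⋆_ : Bool → ℚ → ℚ
b ⋆ q = if b then q else 0ℚ

infixr 8 _⋆_

𝟙 : Bool → ℚ
𝟙 b = b ⋆ 1ℚ

⋆-*ʳ : ∀ b p q → b ⋆ (p * q) ≡ (b ⋆ p) * q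
⋆-*ʳ true  p q = refl
⋆-*ʳ false p q = sym (ℚP.*-zeroˡ q)

⋆≡𝟙* : ∀ b q → b ⋆ q ≡ 𝟙 b * q
⋆≡𝟙* true  q = sym (ℚP.*-identityˡ q)
⋆≡𝟙* false q = sym (ℚP.*-zeroˡ q)

⋆-zeroʳ : ∀ b → b ⋆ 0ℚ ≡ 0ℚ
⋆-zeroʳ true  = refl
⋆-zeroʳ false = refl

⋆-cong : ∀ b {p q} → (T b → p ≡ q) → b ⋆ p ≡ b ⋆ q
⋆-cong true  h = h tt
⋆-cong false h = refl

⋆-mono-≤ : ∀ b {p q} → (T b → p ≤ℚ q) → b ⋆ p ≤ℚ b ⋆ q
⋆-mono-≤ true  h = h tt
⋆-mono-≤ false h = ℚP.≤-refl

𝟙*-cong : ∀ b {p q} → (T b → p ≡ q) → 𝟙 b * p ≡ 𝟙 b * q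
𝟙*-cong true  h = cong (1ℚ *_) (h tt)
𝟙*-cong false {p} {q} h = trans (ℚP.*-zeroˡ p) (sym (ℚP.*-zeroˡ q))

*-⋆ : ∀ b p q → p * (b ⋆ q) ≡ b ⋆ (p * q)
*-⋆ true  p q = refl
*-⋆ false p q = ℚP.*-zeroʳ p

𝟙-∧ : ∀ a b → 𝟙 (a ∧ b) ≡ a ⋆ 𝟙 b
𝟙-∧ true  b = refl
𝟙-∧ false b = refl

T-does : ∀ {P : Set} (d : Dec P) → T (does d) ⇔ P
T-does (yes p) = mk⇔ (λ _ → p) (λ _ → tt)
T-does (no ¬p) = mk⇔ (λ ()) ¬p

T-allB : ∀ {A : Set} (f : A → Bool) (l : List A) → T (allB f l) ⇔ (∀ a → a ∈ₗ l → T (f a))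
T-allB f []      = mk⇔ (λ _ _ ()) (λ _ → tt)
T-allB f (a ∷ l) = mk⇔
  (λ t → let (fa , rest) = to BoolP.T-∧ t in
         λ { b (here refl) → fa ; b (there b∈l) → to (T-allB f l) rest b b∈l })
  (λ h → from BoolP.T-∧ (h a (here refl) , from (T-allB f l) (λ b → h b ∘ there)))

T-allB-allFin : ∀ {n} (f : Fin n → Bool) → T (allB f (allFin n)) ⇔ (∀ y → T (f y))
T-allB-allFin {n} f = mk⇔ (λ t y → to (T-allB f (allFin n)) t y (∈-allFin y))
                          (λ h → from (T-allB f (allFin n)) (λ y _ → h y))

-- Unlike SubsetP._∈?_, its decision is definitionally lookup S x.
_∈ᵇ?_ : ∀ {n} (x : Fin n) (S : Subset n) → Dec (x ∈ S)
x ∈ᵇ? S = Dec.map′ (VecP.lookup⇒[]= x S ∘ to BoolP.T-≡)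
                   (from BoolP.T-≡ ∘ VecP.[]=⇒lookup) (T? (lookup S x))

T-lookup : ∀ {n} {x : Fin n} {S} → T (lookup S x) ⇔ x ∈ S
T-lookup {x = x} {S} = T-does (x ∈ᵇ? S)

-- Finite sums

∑ : {A : Set} → List A → (A → ℚ) → ℚ
∑ l f = sumℚ (List.map f l)

syntax ∑ l (λ a → e) = ∑[ a ∈ l ] e

module _ {A : Set} where

  ∑-cong : ∀ (l : List A) {f g : A → ℚ} → (∀ a → f a ≡ g a) → ∑ l f ≡ ∑ l g
  ∑-cong []      e = refl
  ∑-cong (a ∷ l) e = cong₂ _+_ (e a) (∑-cong l e)

  ∑-zero : ∀ (l : List A) → ∑[ a ∈ l ] 0ℚ ≡ 0ℚ
  ∑-zero []      = refl
  ∑-zero (a ∷ l) = trans (ℚP.+-identityˡ _) (∑-zero l)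

  ∑-+ : ∀ (l : List A) (f g : A → ℚ) → ∑[ a ∈ l ] (f a + g a) ≡ ∑ l f + ∑ l g
  ∑-+ []      f g = refl
  ∑-+ (a ∷ l) f g = trans (cong (f a + g a +_) (∑-+ l f g)) (+-interchange (f a) (g a) _ _)

  ∑-*ˡ : ∀ (l : List A) c (f : A → ℚ) → ∑[ a ∈ l ] (c * f a) ≡ c * ∑ l f
  ∑-*ˡ []      c f = sym (ℚP.*-zeroʳ c)
  ∑-*ˡ (a ∷ l) c f = trans (cong (c * f a +_) (∑-*ˡ l c f)) (sym (ℚP.*-distribˡ-+ c (f a) _))

  ∑-*ʳ : ∀ (l : List A) c (f : A → ℚ) → ∑[ a ∈ l ] (f a * c) ≡ ∑ l f * c
  ∑-*ʳ l c f = trans (∑-cong l (λ a → ℚP.*-comm (f a) c)) (trans (∑-*ˡ l c f) (ℚP.*-comm c _))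

  ∑-⋆ : ∀ (l : List A) b (f : A → ℚ) → ∑[ a ∈ l ] (b ⋆ f a) ≡ b ⋆ ∑ l f
  ∑-⋆ l true  f = refl
  ∑-⋆ l false f = ∑-zero l

  ∑-mono-≤ : ∀ (l : List A) {f g : A → ℚ} → (∀ a → f a ≤ℚ g a) → ∑ l f ≤ℚ ∑ l g
  ∑-mono-≤ []      le = ℚP.≤-refl
  ∑-mono-≤ (a ∷ l) le = ℚP.+-mono-≤ (le a) (∑-mono-≤ l le)

  ∑-++ : ∀ (l m : List A) (f : A → ℚ) → ∑ (l ++ m) f ≡ ∑ l f + ∑ m f
  ∑-++ []      m f = sym (ℚP.+-identityˡ _)
  ∑-++ (a ∷ l) m f = trans (cong (f a +_) (∑-++ l m f)) (sym (ℚP.+-assoc (f a) _ _))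

  ∑-≤-≡⇒≡ : ∀ (l : List A) {f g : A → ℚ} → (∀ a → f a ≤ℚ g a) → ∑ l f ≡ ∑ l g →
            ∀ {a} → a ∈ₗ l → f a ≡ g a
  ∑-≤-≡⇒≡ (b ∷ l) le e (here refl) = proj₁ (+-≤-≡⇒≡ (le b) (∑-mono-≤ l le) e)
  ∑-≤-≡⇒≡ (b ∷ l) le e (there a∈l) =
    ∑-≤-≡⇒≡ l le (proj₂ (+-≤-≡⇒≡ (le b) (∑-mono-≤ l le) e)) a∈l

∑-0* : ∀ {A : Set} (l : List A) (f : A → ℚ) → ∑[ a ∈ l ] (0ℚ * f a) ≡ 0ℚ
∑-0* l f = trans (∑-cong l (λ a → ℚP.*-zeroˡ (f a))) (∑-zero l)

∑-map : ∀ {A B : Set} (g : A → B) (l : List A) (f : B → ℚ) → ∑ (List.map g l) f ≡ ∑[ a ∈ l ] f (g a)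
∑-map g l f = cong sumℚ (sym (ListP.map-∘ l))

∑-comm : ∀ {A B : Set} (l : List A) (m : List B) (h : A → B → ℚ) →
         ∑[ a ∈ l ] ∑[ b ∈ m ] h a b ≡ ∑[ b ∈ m ] ∑[ a ∈ l ] h a b
∑-comm []      m h = sym (∑-zero m)
∑-comm (a ∷ l) m h = trans (cong (∑ m (h a) +_) (∑-comm l m h)) (sym (∑-+ m (h a) _))

module ℚ+ = MonoidSum ℚP.+-0-commutativeMonoid

∑-allFin-suc : ∀ n (f : Fin (suc n) → ℚ) →
               ∑ (allFin (suc n)) f ≡ f zero + ∑[ i ∈ allFin n ] f (suc i)
∑-allFin-suc n f =
  cong (λ l → f zero + sumℚ l) (trans (ListP.map-tabulate suc f) (sym (ListP.map-tabulate id (f ∘ suc))))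

∑-allFin≡sum : ∀ n (f : Fin n → ℚ) → ∑ (allFin n) f ≡ ℚ+.sum f
∑-allFin≡sum zero    f = refl
∑-allFin≡sum (suc n) f = trans (∑-allFin-suc n f) (cong (f zero +_) (∑-allFin≡sum n (f ∘ suc)))

∑-permute : ∀ n (f : Fin n → ℚ) (π : Permutation′ n) →
            ∑ (allFin n) f ≡ ∑[ i ∈ allFin n ] f (π ⟨$⟩ʳ i)
∑-permute n f π = trans (∑-allFin≡sum n f) (trans (ℚ+.sum-permute f π) (sym (∑-allFin≡sum n _)))

∑-δ : ∀ n (j : Fin n) a → ∑[ i ∈ allFin n ] (does (i Fin.≟ j) ⋆ a) ≡ a
∑-δ (suc n) zero    a = trans (∑-allFin-suc n (λ i → does (i Fin.≟ zero) ⋆ a))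
                              (trans (cong (a +_) (∑-zero (allFin n))) (ℚP.+-identityʳ a))
∑-δ (suc n) (suc j) a = trans (∑-allFin-suc n (λ i → does (i Fin.≟ suc j) ⋆ a))
                              (trans (ℚP.+-identityˡ _) (∑-δ n j a))

∑-𝟙-unique : ∀ n (b : Fin n → Bool) j → T (b j) → (∀ i → T (b i) → i ≡ j) →
             ∑[ i ∈ allFin n ] 𝟙 (b i) ≡ 1ℚ
∑-𝟙-unique n b j bj unique = trans (∑-cong (allFin n) 𝟙b≡δ) (∑-δ n j 1ℚ)
  where
  𝟙b≡δ : ∀ i → 𝟙 (b i) ≡ does (i Fin.≟ j) ⋆ 1ℚ
  𝟙b≡δ i with i Fin.≟ j
  ... | yes refl = cong 𝟙 (to BoolP.T-≡ bj)
  ... | no  i≢j  = cong 𝟙 (dec-false (T? (b i)) (i≢j ∘ unique i))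

∑-𝟙-toℕ< : ∀ n k → k ≤ n → ∑[ i ∈ allFin n ] 𝟙 (toℕ i ℕ.<ᵇ k) ≡ ℕtoℚ k
∑-𝟙-toℕ< n       zero    _         = ∑-zero (allFin n)
∑-𝟙-toℕ< (suc n) (suc k) (ℕ.s≤s k≤n) =
  trans (∑-allFin-suc n (λ i → 𝟙 (toℕ i ℕ.<ᵇ suc k)))
        (trans (cong (1ℚ +_) (∑-𝟙-toℕ< n k k≤n)) (sym (ℕtoℚ-+ 1 k)))

sumOver-∷ : ∀ {n} s (S : Subset n) f → sumOver (s ∷ S) f ≡ s ⋆ f zero + sumOver S (f ∘ suc)
sumOver-∷ s S f = ∑-allFin-suc _ (λ x → lookup (s ∷ S) x ⋆ f x)

sumOver-const : ∀ {n} (S : Subset n) c → sumOver S (λ _ → c) ≡ ℕtoℚ ∣ S ∣ * c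
sumOver-const []            c = sym (ℚP.*-zeroˡ c)
sumOver-const (outside ∷ S) c =
  trans (sumOver-∷ outside S (λ _ → c)) (trans (ℚP.+-identityˡ _) (sumOver-const S c))
sumOver-const (inside ∷ S)  c = begin
  sumOver (inside ∷ S) (λ _ → c) ≡⟨ sumOver-∷ inside S (λ _ → c) ⟩
  c + sumOver S (λ _ → c)       ≡⟨ cong (c +_) (sumOver-const S c) ⟩
  c + ℕtoℚ ∣ S ∣ * c            ≡⟨ cong (_+ ℕtoℚ ∣ S ∣ * c) (sym (ℚP.*-identityˡ c)) ⟩
  1ℚ * c + ℕtoℚ ∣ S ∣ * c       ≡⟨ sym (ℚP.*-distribʳ-+ c 1ℚ (ℕtoℚ ∣ S ∣)) ⟩
  (1ℚ + ℕtoℚ ∣ S ∣) * c         ≡⟨ cong (_* c) (sym (ℕtoℚ-+ 1 ∣ S ∣)) ⟩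
  ℕtoℚ (suc ∣ S ∣) * c          ∎
  where open ≡-Reasoning

sumOver-constant : ∀ {n} (S : Subset n) {f : Fin n → ℚ} c → (∀ x → x ∈ S → f x ≡ c) →
                   sumOver S f ≡ ℕtoℚ ∣ S ∣ * c
sumOver-constant {n} S c f≡c =
  trans (∑-cong (allFin n) λ x → ⋆-cong (lookup S x) (f≡c x ∘ to T-lookup)) (sumOver-const S c)

sumOver-*ˡ : ∀ {n} (S : Subset n) c (f : Fin n → ℚ) → sumOver S (λ x → c * f x) ≡ c * sumOver S f
sumOver-*ˡ {n} S c f = trans (∑-cong (allFin n) (λ x → sym (*-⋆ (lookup S x) c (f x)))) (∑-*ˡ (allFin n) c _)

sumOver-*ʳ : ∀ {n} (S : Subset n) (f : Fin n → ℚ) c → sumOver S (λ x → f x * c) ≡ sumOver S f * c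
sumOver-*ʳ {n} S f c = trans (∑-cong (allFin n) (λ x → ⋆-*ʳ (lookup S x) (f x) c)) (∑-*ʳ (allFin n) c _)

sumOver-≤-≡⇒≡ : ∀ {n} (S : Subset n) {f g : Fin n → ℚ} → (∀ y → y ∈ S → f y ≤ℚ g y) →
                sumOver S f ≡ sumOver S g → ∀ {x} → x ∈ S → f x ≡ g x
sumOver-≤-≡⇒≡ {n} S {f} {g} f≤g e {x} x∈S = subst (λ b → b ⋆ f x ≡ b ⋆ g x) (VecP.[]=⇒lookup x∈S)
  (∑-≤-≡⇒≡ (allFin n) (λ y → ⋆-mono-≤ (lookup S y) (f≤g y ∘ to T-lookup)) e (∈-allFin x))

sumOver-δ : ∀ {n} {Y : Subset n} {x} → x ∈ Y → ∀ c (f : Fin n → ℚ) →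
            sumOver Y (λ z → (does (z Fin.≟ x) ⋆ c) * f z) ≡ c * f x
sumOver-δ {n} {Y} {x} x∈Y c f = trans (∑-cong (allFin n) only-x) (∑-δ n x (c * f x))
  where
  only-x : ∀ z → lookup Y z ⋆ ((does (z Fin.≟ x) ⋆ c) * f z) ≡ does (z Fin.≟ x) ⋆ (c * f x)
  only-x z with z Fin.≟ x
  ... | yes refl = cong (_⋆ (c * f x)) (VecP.[]=⇒lookup x∈Y)
  ... | no  _    = trans (cong (lookup Y z ⋆_) (ℚP.*-zeroˡ (f z))) (⋆-zeroʳ (lookup Y z))

-- Subsets

infix 4 _≟ₛ_

-- The decision procedure of prefixIs.
_≟ₛ_ : ∀ {n} → DecidableEquality (Subset n)
_≟ₛ_ = VecP.≡-dec BoolP._≟_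

allSubsets : ∀ n → List (Subset n)
allSubsets zero    = [] ∷ []
allSubsets (suc n) = List.map (outside ∷_) (allSubsets n) ++ List.map (inside ∷_) (allSubsets n)

∑-allSubsets-suc : ∀ n (g : Subset (suc n) → ℚ) →
  ∑ (allSubsets (suc n)) g ≡ ∑[ S ∈ allSubsets n ] g (outside ∷ S) + ∑[ S ∈ allSubsets n ] g (inside ∷ S)
∑-allSubsets-suc n g = trans (∑-++ (List.map (outside ∷_) (allSubsets n)) _ g)
  (cong₂ _+_ (∑-map (outside ∷_) (allSubsets n) g) (∑-map (inside ∷_) (allSubsets n) g))

∑-allSubsets-δ : ∀ n (U : Subset n) a → ∑[ S ∈ allSubsets n ] (does (S ≟ₛ U) ⋆ a) ≡ a
∑-allSubsets-δ zero    []            a = ℚP.+-identityʳ a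
∑-allSubsets-δ (suc n) (outside ∷ U) a =
  trans (∑-allSubsets-suc n (λ S → does (S ≟ₛ outside ∷ U) ⋆ a))
        (trans (cong₂ _+_ (∑-allSubsets-δ n U a) (∑-zero (allSubsets n))) (ℚP.+-identityʳ a))
∑-allSubsets-δ (suc n) (inside ∷ U)  a =
  trans (∑-allSubsets-suc n (λ S → does (S ≟ₛ inside ∷ U) ⋆ a))
        (trans (cong₂ _+_ (∑-zero (allSubsets n)) (∑-allSubsets-δ n U a)) (ℚP.+-identityˡ a))

module _ {n : ℕ} (p : Subset n → Bool) {S₀ : Subset n} (pS₀ : T (p S₀)) where

  private
    p∖S₀ : Subset n → Bool
    p∖S₀ S = p S ∧ not (does (S ≟ₛ S₀))

    below : (Subset n → ℚ) → ℚ
    below f = ∑[ S ∈ allSubsets n ] (𝟙 (p∖S₀ S) * f S)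

    ∑-split-at : ∀ (f : Subset n → ℚ) → ∑[ S ∈ allSubsets n ] (𝟙 (p S) * f S) ≡ f S₀ + below f
    ∑-split-at f = trans (∑-cong (allSubsets n) split)
      (trans (∑-+ (allSubsets n) _ _) (cong (_+ below f) (∑-allSubsets-δ n S₀ (f S₀))))
      where
      split : ∀ S → 𝟙 (p S) * f S ≡ does (S ≟ₛ S₀) ⋆ f S₀ + 𝟙 (p∖S₀ S) * f S
      split S with S ≟ₛ S₀
      ... | yes refl rewrite to BoolP.T-≡ pS₀ =
        trans (ℚP.*-identityˡ (f S)) (sym (trans (cong (f S +_) (ℚP.*-zeroˡ (f S))) (ℚP.+-identityʳ (f S))))
      ... | no _ rewrite BoolP.∧-identityʳ (p S) = sym (ℚP.+-identityˡ _)

  ∑-agree-below : ∀ (f g : Subset n → ℚ) → (∀ S → T (p S) → S ≢ S₀ → f S ≡ g S) →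
    ∑[ S ∈ allSubsets n ] (𝟙 (p S) * f S) + g S₀ ≡ ∑[ S ∈ allSubsets n ] (𝟙 (p S) * g S) + f S₀
  ∑-agree-below f g agree = begin
    ∑[ S ∈ allSubsets n ] (𝟙 (p S) * f S) + g S₀  ≡⟨ cong (_+ g S₀) (∑-split-at f) ⟩
    f S₀ + below f + g S₀                          ≡⟨ cong (λ r → f S₀ + r + g S₀) below-agree ⟩
    f S₀ + below g + g S₀                          ≡⟨ [x+y]+z≡[z+y]+x (f S₀) (below g) (g S₀) ⟩
    g S₀ + below g + f S₀                          ≡⟨ cong (_+ f S₀) (sym (∑-split-at g)) ⟩
    ∑[ S ∈ allSubsets n ] (𝟙 (p S) * g S) + f S₀  ∎
    where
    open ≡-Reasoning
    below-agree : below f ≡ below g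
    below-agree = ∑-cong (allSubsets n) λ S → guarded S (p S) refl (S ≟ₛ S₀)
      where
      guarded : ∀ S b → p S ≡ b → (d : Dec (S ≡ S₀)) →
                𝟙 (b ∧ not (does d)) * f S ≡ 𝟙 (b ∧ not (does d)) * g S
      guarded S true  pS (no S≢S₀) = cong (1ℚ *_) (agree S (from BoolP.T-≡ pS) S≢S₀)
      guarded S true  pS (yes _)   = trans (ℚP.*-zeroˡ (f S)) (sym (ℚP.*-zeroˡ (g S)))
      guarded S false pS d         = trans (ℚP.*-zeroˡ (f S)) (sym (ℚP.*-zeroˡ (g S)))

∣S∪⁅x⁆∣ : ∀ {n} (S : Subset n) x → x ∉ S → ∣ S ∪ ⁅ x ⁆ ∣ ≡ suc ∣ S ∣
∣S∪⁅x⁆∣ (outside ∷ S) zero    _   = cong (suc ∘ ∣_∣) (SubsetP.∪-identityʳ S)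
∣S∪⁅x⁆∣ (inside  ∷ S) zero    x∉S = contradiction here x∉S
∣S∪⁅x⁆∣ (outside ∷ S) (suc x) x∉S = ∣S∪⁅x⁆∣ S x (x∉S ∘ there)
∣S∪⁅x⁆∣ (inside  ∷ S) (suc x) x∉S = cong suc (∣S∪⁅x⁆∣ S x (x∉S ∘ there))

⊆∧≢⇒⊂ : ∀ {n} {S U : Subset n} → S ⊆ U → S ≢ U → S ⊂ U
⊆∧≢⇒⊂ {S = []}          {[]}          _   S≢U = contradiction refl S≢U
⊆∧≢⇒⊂ {S = inside  ∷ S} {outside ∷ U} S⊆U _   = contradiction (S⊆U here) λ ()
⊆∧≢⇒⊂ {S = outside ∷ S} {inside  ∷ U} S⊆U _   = SubsetP.out⊂in (SubsetP.drop-∷-⊆ S⊆U)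
⊆∧≢⇒⊂ {S = outside ∷ S} {outside ∷ U} S⊆U S≢U =
  SubsetP.s⊂s (⊆∧≢⇒⊂ (SubsetP.drop-∷-⊆ S⊆U) (S≢U ∘ cong (outside ∷_)))
⊆∧≢⇒⊂ {S = inside  ∷ S} {inside  ∷ U} S⊆U S≢U =
  SubsetP.s⊂s (⊆∧≢⇒⊂ (SubsetP.drop-∷-⊆ S⊆U) (S≢U ∘ cong (inside ∷_)))

module _ {n : ℕ} where

  ∈⇒0<∣∣ : ∀ {x : Fin n} {S} → x ∈ S → 0 ℕ.< ∣ S ∣
  ∈⇒0<∣∣ x∈S = ℕP.≤-<-trans ℕ.z≤n (SubsetP.x∈p⇒∣p-x∣<∣p∣ x∈S)

  ∈∪⁅⁆⇔ : ∀ {S : Subset n} {x y} → y ∈ S ∪ ⁅ x ⁆ ⇔ (y ∈ S ⊎ y ≡ x)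
  ∈∪⁅⁆⇔ {S} {x} = mk⇔
    (λ y∈ → Sum.map₂ (SubsetP.x∈⁅y⁆⇒x≡y x) (SubsetP.x∈p∪q⁻ S ⁅ x ⁆ y∈))
    (λ { (inj₁ y∈S) → SubsetP.x∈p∪q⁺ (inj₁ y∈S)
       ; (inj₂ refl) → SubsetP.x∈p∪q⁺ (inj₂ (SubsetP.x∈⁅x⁆ x)) })

  x∈S∪⁅x⁆ : ∀ (S : Subset n) x → x ∈ S ∪ ⁅ x ⁆
  x∈S∪⁅x⁆ S x = from ∈∪⁅⁆⇔ (inj₂ refl)

  S⊂S∪⁅x⁆ : ∀ {S : Subset n} {x} → x ∉ S → S ⊂ S ∪ ⁅ x ⁆
  S⊂S∪⁅x⁆ {S} {x} x∉S = SubsetP.p⊆p∪q ⁅ x ⁆ , x , x∈S∪⁅x⁆ S x , x∉S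

  ∪⁅⁆-injective : ∀ {S U : Subset n} {x} → x ∉ S → x ∉ U → S ∪ ⁅ x ⁆ ≡ U ∪ ⁅ x ⁆ → S ≡ U
  ∪⁅⁆-injective {S} {U} {x} x∉S x∉U e = SubsetP.⊆-antisym (into x∉S e) (into x∉U (sym e))
    where
    into : ∀ {A B} → x ∉ A → A ∪ ⁅ x ⁆ ≡ B ∪ ⁅ x ⁆ → A ⊆ B
    into x∉A e y∈A with to ∈∪⁅⁆⇔ (subst (_ ∈_) e (SubsetP.p⊆p∪q ⁅ x ⁆ y∈A))
    ... | inj₁ y∈B = y∈B
    ... | inj₂ refl = contradiction y∈A x∉A

  ∣∁S∪⁅x⁆∣ : ∀ {S : Subset n} {x} → x ∈ S → ∣ ∁ S ∪ ⁅ x ⁆ ∣ ≡ suc (n ℕ.∸ ∣ S ∣)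
  ∣∁S∪⁅x⁆∣ {S} {x} x∈S =
    trans (∣S∪⁅x⁆∣ (∁ S) x (SubsetP.x∈p⇒x∉∁p x∈S)) (cong suc (SubsetP.∣∁p∣≡n∸∣p∣ S))

  ∁S∪⁅x⁆-involutive : ∀ {S : Subset n} {x} → x ∈ S → ∁ (∁ S ∪ ⁅ x ⁆) ∪ ⁅ x ⁆ ≡ S
  ∁S∪⁅x⁆-involutive {S} {x} x∈S = SubsetP.⊆-antisym ⊆S S⊆
    where
    ⊆S : ∁ (∁ S ∪ ⁅ x ⁆) ∪ ⁅ x ⁆ ⊆ S
    ⊆S y∈ with to ∈∪⁅⁆⇔ y∈
    ... | inj₁ y∈∁ = SubsetP.x∉∁p⇒x∈p (SubsetP.x∈∁p⇒x∉p y∈∁ ∘ SubsetP.p⊆p∪q ⁅ x ⁆)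
    ... | inj₂ refl = x∈S
    S⊆ : S ⊆ ∁ (∁ S ∪ ⁅ x ⁆) ∪ ⁅ x ⁆
    S⊆ {y} y∈S with y Fin.≟ x
    ... | yes refl = x∈S∪⁅x⁆ _ x
    ... | no  y≢x  = SubsetP.p⊆p∪q ⁅ x ⁆ (SubsetP.x∉p⇒x∈∁p y∉)
      where
      y∉ : y ∉ ∁ S ∪ ⁅ x ⁆
      y∉ y∈ with to ∈∪⁅⁆⇔ y∈
      ... | inj₁ y∈∁S = SubsetP.x∈∁p⇒x∉p y∈∁S y∈S
      ... | inj₂ y≡x  = y≢x y≡x

sizeSum : ℕ → (ℕ → ℚ) → ℚ
sizeSum m g = ∑[ S ∈ allSubsets m ] g ∣ S ∣

sizeSum-suc : ∀ m g → sizeSum (suc m) g ≡ sizeSum m g + sizeSum m (g ∘ suc)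
sizeSum-suc m g = ∑-allSubsets-suc m (g ∘ ∣_∣)

∑-between : ∀ {n} → Fin n → Subset n → (Subset n → ℚ) → ℚ
∑-between {n} a A f = ∑[ S ∈ allSubsets n ] (𝟙 (does (a ∈? S) ∧ does (S ⊆? A)) * f S)

∑-⊆-bySize : ∀ {n} (A : Subset n) (g : ℕ → ℚ) →
  ∑[ S ∈ allSubsets n ] (𝟙 (does (S ⊆? A)) * g ∣ S ∣) ≡ sizeSum ∣ A ∣ g
∑-⊆-bySize []            g = cong (_+ 0ℚ) (ℚP.*-identityˡ (g 0))
∑-⊆-bySize {suc n} (outside ∷ A) g =
  trans (∑-allSubsets-suc n (λ S → 𝟙 (does (S ⊆? outside ∷ A)) * g ∣ S ∣))
        (trans (cong₂ _+_ (∑-⊆-bySize A g) (∑-0* (allSubsets n) (λ S → g (suc ∣ S ∣)))) (ℚP.+-identityʳ _))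
∑-⊆-bySize {suc n} (inside ∷ A)  g =
  trans (∑-allSubsets-suc n (λ S → 𝟙 (does (S ⊆? inside ∷ A)) * g ∣ S ∣))
        (trans (cong₂ _+_ (∑-⊆-bySize A g) (∑-⊆-bySize A (g ∘ suc))) (sym (sizeSum-suc ∣ A ∣ g)))

∑-between-bySize : ∀ {n} {A : Subset n} {x} (g : ℕ → ℚ) m → x ∈ A → ∣ A ∣ ≡ suc m →
  ∑-between x A (λ S → g ∣ S ∣) ≡ sizeSum m (g ∘ suc)
∑-between-bySize {suc n} {A = inside ∷ A} {zero} g m here ∣A∣≡1+m =
  trans (∑-allSubsets-suc n (λ S → 𝟙 (does (zero ∈? S) ∧ does (S ⊆? inside ∷ A)) * g ∣ S ∣))
        (trans (cong₂ _+_ (∑-0* (allSubsets n) (g ∘ ∣_∣)) (∑-⊆-bySize A (g ∘ suc)))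
               (trans (ℚP.+-identityˡ _) (cong (λ k → sizeSum k (g ∘ suc)) (ℕP.suc-injective ∣A∣≡1+m))))
∑-between-bySize {suc n} {A = outside ∷ A} {suc x} g m (there x∈A) ∣A∣≡1+m =
  trans (∑-allSubsets-suc n (λ S → 𝟙 (does (suc x ∈? S) ∧ does (S ⊆? outside ∷ A)) * g ∣ S ∣))
        (trans (cong₂ _+_ (∑-between-bySize g m x∈A ∣A∣≡1+m) outside-part) (ℚP.+-identityʳ _))
  where
  outside-part : ∑[ S ∈ allSubsets n ] (𝟙 (does (x ∈? S) ∧ false) * g (suc ∣ S ∣)) ≡ 0ℚ
  outside-part =
    trans (∑-cong (allSubsets n) λ S → cong (λ b → 𝟙 b * g (suc ∣ S ∣)) (BoolP.∧-zeroʳ (does (x ∈? S))))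
          (∑-0* (allSubsets n) (λ S → g (suc ∣ S ∣)))
∑-between-bySize {suc n} {A = inside ∷ A} {suc x} g (suc m) (there x∈A) ∣A∣≡2+m =
  trans (∑-allSubsets-suc n (λ S → 𝟙 (does (suc x ∈? S) ∧ does (S ⊆? inside ∷ A)) * g ∣ S ∣))
        (trans (cong₂ _+_ (∑-between-bySize g m x∈A ∣A∣≡1+m)
                          (∑-between-bySize (g ∘ suc) m x∈A ∣A∣≡1+m))
               (sym (sizeSum-suc m (g ∘ suc))))
  where ∣A∣≡1+m = ℕP.suc-injective ∣A∣≡2+m
∑-between-bySize {A = inside ∷ A} {suc x} g zero (there x∈A) ∣A∣≡1 =
  contradiction (ℕP.suc-injective ∣A∣≡1) (ℕP.>⇒≢ (∈⇒0<∣∣ x∈A))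

-- Prefixes of a permutation

-- π follows the edge (S , S ∖ {x}) of the transition graph: π([|S|]) = S and π(|S|) = x.
traverses : ∀ {n} → Subset n → Fin n → Event n
traverses S x = lastIs S x ∧ᴱ prefixIs S

module Prefixes {n : ℕ} (π : Permutation′ n) where

  prefixAt : Fin n → Subset n
  prefixAt x = prefixSet (suc (pos π x)) π

  ∈prefixSet⇔ : ∀ {k y} → y ∈ prefixSet k π ⇔ pos π y ℕ.< k
  ∈prefixSet⇔ {k} {y} = mk⇔
    (λ y∈ → to (T-does (pos π y ℕP.<? k)) (subst T lookup-prefixSet (from T-lookup y∈)))
    (λ lt → to T-lookup (subst T (sym lookup-prefixSet) (from (T-does (pos π y ℕP.<? k)) lt)))
    where
    lookup-prefixSet : lookup (prefixSet k π) y ≡ (pos π y ℕ.<ᵇ k)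
    lookup-prefixSet = VecP.lookup∘tabulate (λ z → pos π z ℕ.<ᵇ k) y

  x∈prefixAt : ∀ x → x ∈ prefixAt x
  x∈prefixAt x = from ∈prefixSet⇔ (ℕP.n<1+n (pos π x))

  pos-⟨$⟩ʳ : ∀ i → pos π (π ⟨$⟩ʳ i) ≡ toℕ i
  pos-⟨$⟩ʳ i = cong toℕ (Perm.inverseˡ π)

  pos-injective : ∀ {x y} → pos π x ≡ pos π y → x ≡ y
  pos-injective e =
    trans (sym (Perm.inverseʳ π)) (trans (cong (π ⟨$⟩ʳ_) (FinP.toℕ-injective e)) (Perm.inverseʳ π))

  pos<n : ∀ x → pos π x ℕ.< n
  pos<n x = FinP.toℕ<n (π ⟨$⟩ˡ x)

  ∣prefixSet∣ : ∀ {k} → k ≤ n → ∣ prefixSet k π ∣ ≡ k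
  ∣prefixSet∣ {k} k≤n = ℕtoℚ-injective (begin
    ℕtoℚ ∣ prefixSet k π ∣                        ≡⟨ sym (ℚP.*-identityʳ _) ⟩
    ℕtoℚ ∣ prefixSet k π ∣ * 1ℚ                   ≡⟨ sym (sumOver-const (prefixSet k π) 1ℚ) ⟩
    sumOver (prefixSet k π) (λ _ → 1ℚ)            ≡⟨ ∑-cong (allFin n) (λ y → cong 𝟙 (VecP.lookup∘tabulate _ y)) ⟩
    ∑[ y ∈ allFin n ] 𝟙 (pos π y ℕ.<ᵇ k)            ≡⟨ ∑-permute n (λ y → 𝟙 (pos π y ℕ.<ᵇ k)) π ⟩
    ∑[ i ∈ allFin n ] 𝟙 (pos π (π ⟨$⟩ʳ i) ℕ.<ᵇ k)
      ≡⟨ ∑-cong (allFin n) (λ i → cong (λ m → 𝟙 (m ℕ.<ᵇ k)) (pos-⟨$⟩ʳ i)) ⟩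
    ∑[ i ∈ allFin n ] 𝟙 (toℕ i ℕ.<ᵇ k)             ≡⟨ ∑-𝟙-toℕ< n k k≤n ⟩
    ℕtoℚ k                                        ∎)
    where open ≡-Reasoning

  ∑-𝟙-pos≡ : ∀ {m} → m ℕ.< n → ∑[ x ∈ allFin n ] 𝟙 (pos π x ℕ.≡ᵇ m) ≡ 1ℚ
  ∑-𝟙-pos≡ {m} m<n = ∑-𝟙-unique n (λ x → pos π x ℕ.≡ᵇ m) j (ℕP.≡⇒≡ᵇ _ _ pos-j) unique
    where
    j = π ⟨$⟩ʳ Fin.fromℕ< m<n
    pos-j : pos π j ≡ m
    pos-j = trans (pos-⟨$⟩ʳ _) (FinP.toℕ-fromℕ< m<n)
    unique : ∀ x → T (pos π x ℕ.≡ᵇ m) → x ≡ j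
    unique x t = pos-injective (trans (ℕP.≡ᵇ⇒≡ _ _ t) (sym pos-j))

  ≡prefixSet⇔ : ∀ {S k} → k ≤ n → S ≡ prefixSet k π ⇔ (prefixSet ∣ S ∣ π ≡ S × k ≡ ∣ S ∣)
  ≡prefixSet⇔ {S} {k} k≤n = mk⇔ forward backward
    where
    forward : S ≡ prefixSet k π → prefixSet ∣ S ∣ π ≡ S × k ≡ ∣ S ∣
    forward refl = cong (λ m → prefixSet m π) (∣prefixSet∣ k≤n) , sym (∣prefixSet∣ k≤n)
    backward : prefixSet ∣ S ∣ π ≡ S × k ≡ ∣ S ∣ → S ≡ prefixSet k π
    backward (P≡S , refl) = sym P≡S

  traverses≡ : ∀ S x → traverses S x π ≡ does (S ≟ₛ prefixAt x)
  traverses≡ S x =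
    does-⇔ (mk⇔ (λ (l , p) → from (≡prefixSet⇔ (pos<n x)) (p , l))
                (λ e → let (p , l) = to (≡prefixSet⇔ (pos<n x)) e in l , p))
           (suc (pos π x) ℕP.≟ ∣ S ∣ ×-dec prefixSet ∣ S ∣ π ≟ₛ S) (S ≟ₛ prefixAt x)

  traverses⇒∈ : ∀ {S x} → T (traverses S x π) → x ∈ S
  traverses⇒∈ {S} {x} t =
    subst (x ∈_) (sym (to (T-does (S ≟ₛ prefixAt x)) (subst T (traverses≡ S x) t))) (x∈prefixAt x)

  ∑-traverses : ∀ x (g : Subset n → ℚ) →
                ∑[ S ∈ allSubsets n ] (g S * 𝟙 (traverses S x π)) ≡ g (prefixAt x)
  ∑-traverses x g = trans (∑-cong (allSubsets n) δ) (∑-allSubsets-δ n (prefixAt x) (g (prefixAt x)))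
    where
    δ : ∀ S → g S * 𝟙 (traverses S x π) ≡ does (S ≟ₛ prefixAt x) ⋆ g (prefixAt x)
    δ S rewrite traverses≡ S x with S ≟ₛ prefixAt x
    ... | yes refl = ℚP.*-identityʳ (g S)
    ... | no  _    = ℚP.*-zeroʳ (g S)

  ∑-traverses-out : ∀ {S} → 0 ℕ.< ∣ S ∣ →
                    ∑[ x ∈ allFin n ] 𝟙 (traverses S x π) ≡ 𝟙 (prefixIs S π)
  ∑-traverses-out {S} 0<∣S∣ = begin
    ∑[ x ∈ allFin n ] 𝟙 (traverses S x π)
      ≡⟨ ∑-cong (allFin n) (λ x → trans (cong 𝟙 (BoolP.∧-comm (lastIs S x π) (prefixIs S π)))
                                        (𝟙-∧ (prefixIs S π) (lastIs S x π))) ⟩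
    ∑[ x ∈ allFin n ] (prefixIs S π ⋆ 𝟙 (suc (pos π x) ℕ.≡ᵇ ∣ S ∣))
      ≡⟨ ∑-⋆ (allFin n) (prefixIs S π) _ ⟩
    prefixIs S π ⋆ ∑[ x ∈ allFin n ] 𝟙 (suc (pos π x) ℕ.≡ᵇ ∣ S ∣)
      ≡⟨ cong (prefixIs S π ⋆_) (one ∣ S ∣ 0<∣S∣ (SubsetP.∣p∣≤n S)) ⟩
    𝟙 (prefixIs S π) ∎
    where
    open ≡-Reasoning
    one : ∀ k → 0 ℕ.< k → k ≤ n → ∑[ x ∈ allFin n ] 𝟙 (suc (pos π x) ℕ.≡ᵇ k) ≡ 1ℚ
    one (suc m) _ m<n = ∑-𝟙-pos≡ m<n

  prefixAt≡ : ∀ x → prefixAt x ≡ prefixSet (pos π x) π ∪ ⁅ x ⁆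
  prefixAt≡ x = SubsetP.⊆-antisym ⊆∪ ∪⊆
    where
    ⊆∪ : prefixAt x ⊆ prefixSet (pos π x) π ∪ ⁅ x ⁆
    ⊆∪ y∈ with ℕP.m≤n⇒m<n∨m≡n (ℕ.s≤s⁻¹ (to ∈prefixSet⇔ y∈))
    ... | inj₁ before = from ∈∪⁅⁆⇔ (inj₁ (from ∈prefixSet⇔ before))
    ... | inj₂ same   = from ∈∪⁅⁆⇔ (inj₂ (pos-injective same))
    ∪⊆ : prefixSet (pos π x) π ∪ ⁅ x ⁆ ⊆ prefixAt x
    ∪⊆ y∈ with to ∈∪⁅⁆⇔ y∈
    ... | inj₁ y∈P = from ∈prefixSet⇔ (ℕP.m<n⇒m<1+n (to ∈prefixSet⇔ y∈P))
    ... | inj₂ refl = x∈prefixAt x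

  traverses-∪⁅⁆ : ∀ {S x} → x ∉ S →
                  traverses (S ∪ ⁅ x ⁆) x π ≡ prefixIs S π ∧ (pos π x ℕ.≡ᵇ ∣ S ∣)
  traverses-∪⁅⁆ {S} {x} x∉S = trans (traverses≡ (S ∪ ⁅ x ⁆) x)
    (does-⇔ (mk⇔ forward backward) (S ∪ ⁅ x ⁆ ≟ₛ prefixAt x)
                                    (prefixSet ∣ S ∣ π ≟ₛ S ×-dec pos π x ℕP.≟ ∣ S ∣))
    where
    x∉P : x ∉ prefixSet (pos π x) π
    x∉P x∈ = ℕP.<-irrefl refl (to ∈prefixSet⇔ x∈)
    S≡P⇔ = ≡prefixSet⇔ {S} (ℕP.<⇒≤ (pos<n x))
    forward : S ∪ ⁅ x ⁆ ≡ prefixAt x → prefixSet ∣ S ∣ π ≡ S × pos π x ≡ ∣ S ∣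
    forward e = to S≡P⇔ (∪⁅⁆-injective x∉S x∉P (trans e (prefixAt≡ x)))
    backward : prefixSet ∣ S ∣ π ≡ S × pos π x ≡ ∣ S ∣ → S ∪ ⁅ x ⁆ ≡ prefixAt x
    backward h = trans (cong (_∪ ⁅ x ⁆) (from S≡P⇔ h)) (sym (prefixAt≡ x))

  ∑-traverses-in : ∀ {S} → ∣ S ∣ ℕ.< n →
    ∑[ x ∈ allFin n ] (not (lookup S x) ⋆ 𝟙 (traverses (S ∪ ⁅ x ⁆) x π)) ≡ 𝟙 (prefixIs S π)
  ∑-traverses-in {S} ∣S∣<n = begin
    ∑[ x ∈ allFin n ] (not (lookup S x) ⋆ 𝟙 (traverses (S ∪ ⁅ x ⁆) x π))
      ≡⟨ ∑-cong (allFin n) (λ x → term x (lookup S x) refl) ⟩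
    ∑[ x ∈ allFin n ] (prefixIs S π ⋆ 𝟙 (pos π x ℕ.≡ᵇ ∣ S ∣))
      ≡⟨ ∑-⋆ (allFin n) (prefixIs S π) _ ⟩
    prefixIs S π ⋆ ∑[ x ∈ allFin n ] 𝟙 (pos π x ℕ.≡ᵇ ∣ S ∣)
      ≡⟨ cong (prefixIs S π ⋆_) (∑-𝟙-pos≡ ∣S∣<n) ⟩
    𝟙 (prefixIs S π) ∎
    where
    open ≡-Reasoning
    term : ∀ x b → lookup S x ≡ b →
           not b ⋆ 𝟙 (traverses (S ∪ ⁅ x ⁆) x π) ≡ prefixIs S π ⋆ 𝟙 (pos π x ℕ.≡ᵇ ∣ S ∣)
    term x false x∉S =
      trans (cong 𝟙 (traverses-∪⁅⁆ (λ x∈S → contradiction (trans (sym (VecP.[]=⇒lookup x∈S)) x∉S) λ ())))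
            (𝟙-∧ (prefixIs S π) (pos π x ℕ.≡ᵇ ∣ S ∣))
    term x true  x∈S = sym (trans (⋆-cong (prefixIs S π) (cong 𝟙 ∘ not-at-∣S∣)) (⋆-zeroʳ (prefixIs S π)))
      where
      not-at-∣S∣ : T (prefixIs S π) → (pos π x ℕ.≡ᵇ ∣ S ∣) ≡ false
      not-at-∣S∣ p = dec-false (pos π x ℕP.≟ ∣ S ∣) (ℕP.<⇒≢ (to ∈prefixSet⇔
        (subst (x ∈_) (sym (to (T-does (prefixSet ∣ S ∣ π ≟ₛ S)) p)) (VecP.lookup⇒[]= x S x∈S))))

  totalCost-traverses : ∀ (c : CostFn n) →
    totalCost c π ≡ ∑[ S ∈ allSubsets n ] ∑[ x ∈ allFin n ] (c x S * 𝟙 (traverses S x π))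
  totalCost-traverses c = begin
    totalCost c π
      ≡⟨ ∑-cong (allFin n) (λ i → cong (λ m → c (π ⟨$⟩ʳ i) (prefixSet (suc m) π))
                                        (sym (pos-⟨$⟩ʳ i))) ⟩
    ∑[ i ∈ allFin n ] c (π ⟨$⟩ʳ i) (prefixAt (π ⟨$⟩ʳ i))
      ≡⟨ sym (∑-permute n (λ x → c x (prefixAt x)) π) ⟩
    ∑[ x ∈ allFin n ] c x (prefixAt x)
      ≡⟨ ∑-cong (allFin n) (λ x → sym (∑-traverses x (c x))) ⟩
    ∑[ x ∈ allFin n ] ∑[ S ∈ allSubsets n ] (c x S * 𝟙 (traverses S x π))
      ≡⟨ ∑-comm (allFin n) (allSubsets n) (λ x S → c x S * 𝟙 (traverses S x π)) ⟩
    ∑[ S ∈ allSubsets n ] ∑[ x ∈ allFin n ] (c x S * 𝟙 (traverses S x π)) ∎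
    where open ≡-Reasoning

  T-lastOf : ∀ {Y x} → T (lastOf Y x π) ⇔ (∀ y → y ∈ Y → pos π y ≤ pos π x)
  T-lastOf {Y} {x} = mk⇔
    (λ t y → to (T-does (y ∈ᵇ? Y →-dec pos π y ℕP.≤? pos π x)) (to (T-allB-allFin _) t y))
    (λ h → from (T-allB-allFin _) (λ y → from (T-does (y ∈ᵇ? Y →-dec pos π y ℕP.≤? pos π x)) (h y)))

  T-firstOf : ∀ {Y x} → T (firstOf Y x π) ⇔ (∀ y → y ∈ Y → pos π x ≤ pos π y)
  T-firstOf {Y} {x} = mk⇔
    (λ t y → to (T-does (y ∈ᵇ? Y →-dec pos π x ℕP.≤? pos π y)) (to (T-allB-allFin _) t y))
    (λ h → from (T-allB-allFin _) (λ y → from (T-does (y ∈ᵇ? Y →-dec pos π x ℕP.≤? pos π y)) (h y)))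

  lastOf≡ : ∀ Y x → lastOf Y x π ≡ does (Y ⊆? prefixAt x)
  lastOf≡ Y x = does-⇔ (mk⇔ forward backward) (T? (lastOf Y x π)) (Y ⊆? prefixAt x)
    where
    forward : T (lastOf Y x π) → Y ⊆ prefixAt x
    forward t {y} y∈Y = from ∈prefixSet⇔ (ℕ.s≤s (to T-lastOf t y y∈Y))
    backward : Y ⊆ prefixAt x → T (lastOf Y x π)
    backward Y⊆ = from T-lastOf (λ y y∈Y → ℕ.s≤s⁻¹ (to ∈prefixSet⇔ (Y⊆ y∈Y)))

  firstOf≡ : ∀ Y x → firstOf Y x π ≡ does (prefixAt x ⊆? ∁ Y ∪ ⁅ x ⁆)
  firstOf≡ Y x = does-⇔ (mk⇔ forward backward) (T? (firstOf Y x π)) (prefixAt x ⊆? ∁ Y ∪ ⁅ x ⁆)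
    where
    forward : T (firstOf Y x π) → prefixAt x ⊆ ∁ Y ∪ ⁅ x ⁆
    forward t {y} y∈P with y Fin.≟ x
    ... | yes refl = x∈S∪⁅x⁆ (∁ Y) x
    ... | no  y≢x  = SubsetP.p⊆p∪q ⁅ x ⁆ (SubsetP.x∉p⇒x∈∁p λ y∈Y →
                       y≢x (pos-injective (ℕP.≤-antisym (ℕ.s≤s⁻¹ (to ∈prefixSet⇔ y∈P)) (to T-firstOf t y y∈Y))))
    backward : prefixAt x ⊆ ∁ Y ∪ ⁅ x ⁆ → T (firstOf Y x π)
    backward P⊆ = from T-firstOf first
      where
      first : ∀ y → y ∈ Y → pos π x ≤ pos π y
      first y y∈Y with pos π x ℕP.≤? pos π y
      ... | yes x≤y = x≤y
      ... | no  x≰y with to ∈∪⁅⁆⇔ (P⊆ (from ∈prefixSet⇔ (ℕ.s≤s (ℕP.<⇒≤ (ℕP.≰⇒> x≰y)))))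
      ...   | inj₁ y∈∁Y = contradiction y∈Y (SubsetP.x∈∁p⇒x∉p y∈∁Y)
      ...   | inj₂ refl = contradiction ℕP.≤-refl x≰y

  𝟙-lastOf : ∀ Y x → 𝟙 (lastOf Y x π) ≡
             ∑[ S ∈ allSubsets n ] (𝟙 (does (Y ⊆? S)) * 𝟙 (traverses S x π))
  𝟙-lastOf Y x = trans (cong 𝟙 (lastOf≡ Y x)) (sym (∑-traverses x (λ S → 𝟙 (does (Y ⊆? S)))))

  𝟙-firstOf : ∀ Y x → 𝟙 (firstOf Y x π) ≡ ∑-between x (∁ Y ∪ ⁅ x ⁆) (λ S → 𝟙 (traverses S x π))
  𝟙-firstOf Y x = begin
    𝟙 (firstOf Y x π)                                 ≡⟨ cong 𝟙 (firstOf≡ Y x) ⟩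
    𝟙 (does (prefixAt x ⊆? ∁ Y ∪ ⁅ x ⁆))
      ≡⟨ cong (λ b → 𝟙 (b ∧ does (prefixAt x ⊆? ∁ Y ∪ ⁅ x ⁆)))
              (sym (dec-true (x ∈? prefixAt x) (x∈prefixAt x))) ⟩
    𝟙 (does (x ∈? prefixAt x) ∧ does (prefixAt x ⊆? ∁ Y ∪ ⁅ x ⁆))
      ≡⟨ sym (∑-traverses x (λ S → 𝟙 (does (x ∈? S) ∧ does (S ⊆? ∁ Y ∪ ⁅ x ⁆)))) ⟩
    ∑-between x (∁ Y ∪ ⁅ x ⁆) (λ S → 𝟙 (traverses S x π))            ∎
    where open ≡-Reasoning

  sumOver-𝟙-lastOf : ∀ {Y x} → x ∈ Y → sumOver Y (λ y → 𝟙 (lastOf Y y π)) ≡ 1ℚ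
  sumOver-𝟙-lastOf {Y} {x} x∈Y =
    trans (∑-cong (allFin n) (λ y → sym (𝟙-∧ (lookup Y y) (lastOf Y y π))))
          (∑-𝟙-unique n (λ y → lookup Y y ∧ lastOf Y y π) ℓ
             (from BoolP.T-∧ (from T-lookup ℓ∈Y , from T-lastOf ℓ-last)) unique)
    where
    Ys = List.filter (_∈ᵇ? Y) (allFin n)
    ℓ = argmax (pos π) x Ys
    ℓ∈Y : ℓ ∈ Y
    ℓ∈Y = argmax-all (pos π) x∈Y (all-filter (_∈ᵇ? Y) (allFin n))
    ℓ-last : ∀ y → y ∈ Y → pos π y ≤ pos π ℓ
    ℓ-last y y∈Y = All.lookup (f[xs]≤f[argmax] x Ys) (∈-filter⁺ (_∈ᵇ? Y) (∈-allFin y) y∈Y)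
    unique : ∀ y → T (lookup Y y ∧ lastOf Y y π) → y ≡ ℓ
    unique y t = let (y∈Y , y-last) = to BoolP.T-∧ t in
      pos-injective (ℕP.≤-antisym (ℓ-last y (to T-lookup y∈Y)) (to T-lastOf y-last ℓ ℓ∈Y))

  sumOver-𝟙-firstOf : ∀ {Y x} → x ∈ Y → sumOver Y (λ y → 𝟙 (firstOf Y y π)) ≡ 1ℚ
  sumOver-𝟙-firstOf {Y} {x} x∈Y =
    trans (∑-cong (allFin n) (λ y → sym (𝟙-∧ (lookup Y y) (firstOf Y y π))))
          (∑-𝟙-unique n (λ y → lookup Y y ∧ firstOf Y y π) ℓ
             (from BoolP.T-∧ (from T-lookup ℓ∈Y , from T-firstOf ℓ-first)) unique)
    where
    Ys = List.filter (_∈ᵇ? Y) (allFin n)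
    ℓ = argmin (pos π) x Ys
    ℓ∈Y : ℓ ∈ Y
    ℓ∈Y = argmin-all (pos π) x∈Y (all-filter (_∈ᵇ? Y) (allFin n))
    ℓ-first : ∀ y → y ∈ Y → pos π ℓ ≤ pos π y
    ℓ-first y y∈Y = All.lookup (f[argmin]≤f[xs] x Ys) (∈-filter⁺ (_∈ᵇ? Y) (∈-allFin y) y∈Y)
    unique : ∀ y → T (lookup Y y ∧ firstOf Y y π) → y ≡ ℓ
    unique y t = let (y∈Y , y-first) = to BoolP.T-∧ t in
      pos-injective (ℕP.≤-antisym (to T-firstOf y-first ℓ ℓ∈Y) (ℓ-first y (to T-lookup y∈Y)))

-- Weights and flows

unitCost : ∀ {n} → CostFn n
unitCost _ _ = 1ℚ

module Flows {n : ℕ} (D : Dist n) where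

  Exp-cong : ∀ {f g : Permutation′ n → ℚ} → (∀ π → f π ≡ g π) → Exp D f ≡ Exp D g
  Exp-cong e = ∑-cong (support D) (λ (w , π) → cong (w *_) (e π))

  Exp-*ˡ : ∀ c (f : Permutation′ n → ℚ) → Exp D (λ π → c * f π) ≡ c * Exp D f
  Exp-*ˡ c f = trans (∑-cong (support D) (λ (w , π) → x*[y*z]≡y*[x*z] w c (f π))) (∑-*ˡ (support D) c _)

  Exp-∑ : ∀ {A : Set} (l : List A) (h : A → Permutation′ n → ℚ) →
          Exp D (λ π → ∑[ a ∈ l ] h a π) ≡ ∑[ a ∈ l ] Exp D (h a)
  Exp-∑ l h =
    trans (∑-cong (support D) (λ (w , π) → sym (∑-*ˡ l w (λ a → h a π)))) (∑-comm (support D) l _)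

  Exp-const : ∀ c → Exp D (λ _ → c) ≡ c
  Exp-const c = trans (∑-*ʳ (support D) c proj₁) (trans (cong (_* c) (total D)) (ℚP.*-identityˡ c))

  Exp-mono-≤ : ∀ {f g : Permutation′ n → ℚ} → (∀ π → f π ≤ℚ g π) → Exp D f ≤ℚ Exp D g
  Exp-mono-≤ {f} {g} f≤g = go (support D) (nonneg D)
    where
    go : ∀ l → All (λ p → 0ℚ ≤ℚ proj₁ p) l → ∑[ (w , π) ∈ l ] (w * f π) ≤ℚ ∑[ (w , π) ∈ l ] (w * g π)
    go []            []ᴬ          = ℚP.≤-refl
    go ((w , π) ∷ l) (0≤w ∷ᴬ 0≤l) =
      ℚP.+-mono-≤ (ℚP.*-monoˡ-≤-nonNeg w {{ℚ.nonNegative 0≤w}} (f≤g π)) (go l 0≤l)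

  Pr≡Exp-𝟙 : ∀ (E : Event n) → Pr D E ≡ Exp D (λ π → 𝟙 (E π))
  Pr≡Exp-𝟙 E = ∑-cong (support D) (λ (w , π) → trans (⋆≡𝟙* (E π) w) (ℚP.*-comm (𝟙 (E π)) w))

  Pr-decompose : ∀ {A : Set} (l : List A) (k : A → ℚ) (E : Event n) (Es : A → Event n) →
    (∀ π → 𝟙 (E π) ≡ ∑[ a ∈ l ] (k a * 𝟙 (Es a π))) → Pr D E ≡ ∑[ a ∈ l ] (k a * Pr D (Es a))
  Pr-decompose l k E Es decomposition = begin
    Pr D E                                       ≡⟨ Pr≡Exp-𝟙 E ⟩
    Exp D (λ π → 𝟙 (E π))                        ≡⟨ Exp-cong decomposition ⟩
    Exp D (λ π → ∑[ a ∈ l ] (k a * 𝟙 (Es a π)))   ≡⟨ Exp-∑ l (λ a π → k a * 𝟙 (Es a π)) ⟩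
    ∑[ a ∈ l ] Exp D (λ π → k a * 𝟙 (Es a π))     ≡⟨ ∑-cong l (λ a → Exp-*ˡ (k a) (λ π → 𝟙 (Es a π))) ⟩
    ∑[ a ∈ l ] (k a * Exp D (λ π → 𝟙 (Es a π)))   ≡⟨ ∑-cong l (λ a → cong (k a *_) (sym (Pr≡Exp-𝟙 (Es a)))) ⟩
    ∑[ a ∈ l ] (k a * Pr D (Es a))               ∎
    where open ≡-Reasoning

  Pr-always : ∀ (E : Event n) → (∀ π → T (E π)) → Pr D E ≡ 1ℚ
  Pr-always E always =
    trans (Pr≡Exp-𝟙 E) (trans (Exp-cong (λ π → cong 𝟙 (to BoolP.T-≡ (always π)))) (Exp-const 1ℚ))

  Pr-never : ∀ (E : Event n) → (∀ π → ¬ T (E π)) → Pr D E ≡ 0ℚ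
  Pr-never E never =
    trans (Pr≡Exp-𝟙 E) (trans (Exp-cong (λ π → cong 𝟙 (dec-false (T? (E π)) (never π)))) (Exp-const 0ℚ))

  Pr-mono-≤ : ∀ (E F : Event n) → (∀ π → T (E π) → T (F π)) → Pr D E ≤ℚ Pr D F
  Pr-mono-≤ E F E⇒F =
    subst₂ _≤ℚ_ (sym (Pr≡Exp-𝟙 E)) (sym (Pr≡Exp-𝟙 F)) (Exp-mono-≤ (λ π → 𝟙-mono (E⇒F π)))
    where
    𝟙-mono : ∀ {a b} → (T a → T b) → 𝟙 a ≤ℚ 𝟙 b
    𝟙-mono {false} {false} _ = ℚP.≤-refl
    𝟙-mono {false} {true}  _ = ℚP.nonNegative⁻¹ 1ℚ
    𝟙-mono {true}  {true}  _ = ℚP.≤-refl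
    𝟙-mono {true}  {false} h = contradiction (h tt) λ ()

  Pr-nonNeg : ∀ (E : Event n) → 0ℚ ≤ℚ Pr D E
  Pr-nonNeg E = subst (_≤ℚ Pr D E) (Pr-never (λ _ → false) (λ _ ())) (Pr-mono-≤ (λ _ → false) E λ _ ())

  sumOver-Pr≡1 : ∀ Y (E : Fin n → Event n) → (∀ π → sumOver Y (λ y → 𝟙 (E y π)) ≡ 1ℚ) →
                 sumOver Y (λ y → Pr D (E y)) ≡ 1ℚ
  sumOver-Pr≡1 Y E exactly-one = begin
    sumOver Y (λ y → Pr D (E y))                     ≡⟨ ∑-cong (allFin n) (λ y → ⋆≡𝟙* (lookup Y y) (Pr D (E y))) ⟩
    ∑[ y ∈ allFin n ] (𝟙 (lookup Y y) * Pr D (E y))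
      ≡⟨ sym (Pr-decompose (allFin n) (λ y → 𝟙 (lookup Y y)) (λ _ → true) E (λ π →
           trans (sym (exactly-one π)) (∑-cong (allFin n) (λ y → ⋆≡𝟙* (lookup Y y) (𝟙 (E y π)))))) ⟩
    Pr D (λ _ → true)                                ≡⟨ Pr-always (λ _ → true) (λ _ → tt) ⟩
    1ℚ                                               ∎
    where open ≡-Reasoning

  weight : Subset n → ℚ
  weight S = Pr D (prefixIs S)

  flow : Subset n → Fin n → ℚ
  flow S x = Pr D (traverses S x)

  flow-nonNeg : ∀ S x → 0ℚ ≤ℚ flow S x
  flow-nonNeg S x = Pr-nonNeg (traverses S x)

  flow≤weight : ∀ S x → flow S x ≤ℚ weight S
  flow≤weight S x = Pr-mono-≤ (traverses S x) (prefixIs S) (λ π → proj₂ ∘ to BoolP.T-∧)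

  flow-∉ : ∀ {S x} → x ∉ S → flow S x ≡ 0ℚ
  flow-∉ {S} {x} x∉S = Pr-never (traverses S x) (λ π → x∉S ∘ Prefixes.traverses⇒∈ π)

  ∑-flow≡sumOver : ∀ S (h : Fin n → ℚ) →
                   ∑[ x ∈ allFin n ] (h x * flow S x) ≡ sumOver S (λ x → h x * flow S x)
  ∑-flow≡sumOver S h = ∑-cong (allFin n) term
    where
    term : ∀ x → h x * flow S x ≡ lookup S x ⋆ (h x * flow S x)
    term x with lookup S x in x∈S?
    ... | true  = refl
    ... | false = trans (cong (h x *_) (flow-∉ λ x∈S → contradiction (trans (sym (VecP.[]=⇒lookup x∈S)) x∈S?) λ ()))
                        (ℚP.*-zeroʳ (h x))

  weight≡sumOver-flow : ∀ {S} → 0 ℕ.< ∣ S ∣ → weight S ≡ sumOver S (flow S)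
  weight≡sumOver-flow {S} 0<∣S∣ = begin
    weight S
      ≡⟨ Pr-decompose (allFin n) (λ _ → 1ℚ) (prefixIs S) (traverses S) (λ π →
           trans (sym (Prefixes.∑-traverses-out π 0<∣S∣))
                 (∑-cong (allFin n) (λ x → sym (ℚP.*-identityˡ (𝟙 (traverses S x π)))))) ⟩
    ∑[ x ∈ allFin n ] (1ℚ * flow S x)  ≡⟨ ∑-flow≡sumOver S (λ _ → 1ℚ) ⟩
    sumOver S (λ x → 1ℚ * flow S x)    ≡⟨ ∑-cong (allFin n) (λ x → cong (lookup S x ⋆_) (ℚP.*-identityˡ (flow S x))) ⟩
    sumOver S (flow S)                 ∎
    where open ≡-Reasoning

  weight≡∑-flow-in : ∀ {S} → ∣ S ∣ ℕ.< n →
                     weight S ≡ ∑[ x ∈ allFin n ] (not (lookup S x) ⋆ flow (S ∪ ⁅ x ⁆) x)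
  weight≡∑-flow-in {S} ∣S∣<n =
    trans (Pr-decompose (allFin n) (λ x → 𝟙 (not (lookup S x))) (prefixIs S) (λ x → traverses (S ∪ ⁅ x ⁆) x)
            (λ π → trans (sym (Prefixes.∑-traverses-in π ∣S∣<n))
                         (∑-cong (allFin n) (λ x → ⋆≡𝟙* (not (lookup S x)) (𝟙 (traverses (S ∪ ⁅ x ⁆) x π))))))
          (∑-cong (allFin n) (λ x → sym (⋆≡𝟙* (not (lookup S x)) (flow (S ∪ ⁅ x ⁆) x))))

  weight-full : ∀ {S} → ∣ S ∣ ≡ n → weight S ≡ 1ℚ
  weight-full {S} ∣S∣≡n = Pr-always (prefixIs S) (λ π → from (T-does (prefixSet ∣ S ∣ π ≟ₛ S)) (prefix≡S π))
    where
    prefix≡S : ∀ π → prefixSet ∣ S ∣ π ≡ S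
    prefix≡S π = trans (SubsetP.∣p∣≡n⇒p≡⊤ (trans (Prefixes.∣prefixSet∣ π (ℕP.≤-reflexive ∣S∣≡n)) ∣S∣≡n))
                       (sym (SubsetP.∣p∣≡n⇒p≡⊤ ∣S∣≡n))

  Exp-totalCost : ∀ (c : CostFn n) →
                  Exp D (totalCost c) ≡ ∑[ S ∈ allSubsets n ] sumOver S (λ x → c x S * flow S x)
  Exp-totalCost c = begin
    Exp D (totalCost c)
      ≡⟨ Exp-cong (λ π → Prefixes.totalCost-traverses π c) ⟩
    Exp D (λ π → ∑[ S ∈ allSubsets n ] ∑[ x ∈ allFin n ] (c x S * 𝟙 (traverses S x π)))
      ≡⟨ Exp-∑ (allSubsets n) (λ S π → ∑[ x ∈ allFin n ] (c x S * 𝟙 (traverses S x π))) ⟩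
    ∑[ S ∈ allSubsets n ] Exp D (λ π → ∑[ x ∈ allFin n ] (c x S * 𝟙 (traverses S x π)))
      ≡⟨ ∑-cong (allSubsets n) (λ S → trans (Exp-∑ (allFin n) (λ x π → c x S * 𝟙 (traverses S x π)))
           (∑-cong (allFin n) (λ x → trans (Exp-*ˡ (c x S) (λ π → 𝟙 (traverses S x π)))
                                           (cong (c x S *_) (sym (Pr≡Exp-𝟙 (traverses S x))))))) ⟩
    ∑[ S ∈ allSubsets n ] ∑[ x ∈ allFin n ] (c x S * flow S x)
      ≡⟨ ∑-cong (allSubsets n) (λ S → ∑-flow≡sumOver S (λ x → c x S)) ⟩
    ∑[ S ∈ allSubsets n ] sumOver S (λ x → c x S * flow S x) ∎
    where open ≡-Reasoning

  Exp-totalCost-unit : Exp D (totalCost unitCost) ≡ ℕtoℚ n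
  Exp-totalCost-unit = trans (Exp-cong (λ _ → ∑-allFin-one n)) (Exp-const (ℕtoℚ n))
    where
    ∑-allFin-one : ∀ m → ∑[ i ∈ allFin m ] 1ℚ ≡ ℕtoℚ m
    ∑-allFin-one zero    = refl
    ∑-allFin-one (suc m) =
      trans (∑-allFin-suc m (λ _ → 1ℚ)) (trans (cong (1ℚ +_) (∑-allFin-one m)) (sym (ℕtoℚ-+ 1 m)))

  Pr-lastOf : ∀ Y x → Pr D (lastOf Y x) ≡ ∑[ S ∈ allSubsets n ] (𝟙 (does (Y ⊆? S)) * flow S x)
  Pr-lastOf Y x = Pr-decompose (allSubsets n) (λ S → 𝟙 (does (Y ⊆? S))) (lastOf Y x) (λ S → traverses S x)
                               (λ π → Prefixes.𝟙-lastOf π Y x)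

  Pr-firstOf : ∀ Y x → Pr D (firstOf Y x) ≡ ∑-between x (∁ Y ∪ ⁅ x ⁆) (λ S → flow S x)
  Pr-firstOf Y x = Pr-decompose (allSubsets n) (λ S → 𝟙 (does (x ∈? S) ∧ does (S ⊆? ∁ Y ∪ ⁅ x ⁆)))
                                (firstOf Y x) (λ S → traverses S x) (λ π → Prefixes.𝟙-firstOf π Y x)

-- The equivalences

-- Its expected cost exceeds n by |Y| Pr[π([|Y|]) = Y ∧ π(|Y|) = x] - Pr[π([|Y|]) = Y].
probe : ∀ {n} → Subset n → Fin n → CostFn n
probe Y x z Z = if does (Z ≟ₛ Y) then does (z Fin.≟ x) ⋆ ℕtoℚ ∣ Y ∣ else 1ℚ

probe-admissible : ∀ {n} {Y : Subset n} {x} → x ∈ Y → Admissible (probe Y x)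
probe-admissible {Y = Y} {x} x∈Y Z _ with Z ≟ₛ Y
... | yes refl = ℚP.≤-reflexive (begin
  sumOver Y (λ z → does (z Fin.≟ x) ⋆ ℕtoℚ ∣ Y ∣)
    ≡⟨ ∑-cong (allFin _) (λ z → cong (lookup Y z ⋆_) (sym (ℚP.*-identityʳ _))) ⟩
  sumOver Y (λ z → (does (z Fin.≟ x) ⋆ ℕtoℚ ∣ Y ∣) * 1ℚ)  ≡⟨ sumOver-δ x∈Y (ℕtoℚ ∣ Y ∣) (λ _ → 1ℚ) ⟩
  ℕtoℚ ∣ Y ∣ * 1ℚ                                        ≡⟨ ℚP.*-identityʳ (ℕtoℚ ∣ Y ∣) ⟩
  ℕtoℚ ∣ Y ∣                                             ∎)
  where open ≡-Reasoning
... | no  _    = ℚP.≤-reflexive (trans (sumOver-const Z 1ℚ) (ℚP.*-identityʳ (ℕtoℚ ∣ Z ∣)))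

module _ {n : ℕ} (D : Dist n) where

  open Flows D

  -- The edge weights 1/|S| of the uniform transition graph, multiplied by w(S).
  UniformTransitions : Set
  UniformTransitions = ∀ S x → x ∈ S → ℕtoℚ ∣ S ∣ * flow S x ≡ weight S

  BalancedFlow : Set
  BalancedFlow = ∀ S x y → x ∈ S → y ∈ S → flow S x ≡ flow S y

  backwardsUniform⇒uniformTransitions : BackwardsUniform 1ℚ D → UniformTransitions
  backwardsUniform⇒uniformTransitions uniform S x x∈S = sumOver-≤-≡⇒≡ S bound sums x∈S
    where
    bound : ∀ y → y ∈ S → ℕtoℚ ∣ S ∣ * flow S y ≤ℚ weight S
    bound y y∈S with weight S ℚP.≤? 0ℚ
    ... | no  w≰0 =
      subst (ℕtoℚ ∣ S ∣ * flow S y ≤ℚ_) (ℚP.*-identityˡ (weight S)) (uniform S (ℚP.≰⇒> w≰0) y y∈S)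
    ... | yes w≤0 =
      subst (_≤ℚ weight S) (sym (trans (cong (ℕtoℚ ∣ S ∣ *_) flow≡0) (ℚP.*-zeroʳ (ℕtoℚ ∣ S ∣))))
            (Pr-nonNeg (prefixIs S))
      where
      flow≡0 : flow S y ≡ 0ℚ
      flow≡0 = ℚP.≤-antisym (ℚP.≤-trans (flow≤weight S y) w≤0) (flow-nonNeg S y)
    sums : sumOver S (λ y → ℕtoℚ ∣ S ∣ * flow S y) ≡ sumOver S (λ _ → weight S)
    sums = begin
      sumOver S (λ y → ℕtoℚ ∣ S ∣ * flow S y)   ≡⟨ sumOver-*ˡ S (ℕtoℚ ∣ S ∣) (flow S) ⟩
      ℕtoℚ ∣ S ∣ * sumOver S (flow S)            ≡⟨ cong (ℕtoℚ ∣ S ∣ *_) (sym (weight≡sumOver-flow (∈⇒0<∣∣ x∈S))) ⟩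
      ℕtoℚ ∣ S ∣ * weight S                      ≡⟨ sym (sumOver-const S (weight S)) ⟩
      sumOver S (λ _ → weight S)                 ∎
      where open ≡-Reasoning

  uniformTransitions⇒backwardsUniform : UniformTransitions → BackwardsUniform 1ℚ D
  uniformTransitions⇒backwardsUniform uniform Y _ x x∈Y =
    ℚP.≤-reflexive (trans (uniform Y x x∈Y) (sym (ℚP.*-identityˡ (weight Y))))

  uniformTransitions⇒balancedFlow : UniformTransitions → BalancedFlow
  uniformTransitions⇒balancedFlow uniform S x y x∈S y∈S =
    ℕtoℚ-*-cancelˡ (∈⇒0<∣∣ x∈S) (trans (uniform S x x∈S) (sym (uniform S y y∈S)))

  balancedFlow⇒uniformTransitions : BalancedFlow → UniformTransitions
  balancedFlow⇒uniformTransitions balanced S x x∈S =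
    sym (trans (weight≡sumOver-flow (∈⇒0<∣∣ x∈S))
               (sumOver-constant S (flow S x) (λ y y∈S → balanced S y x y∈S x∈S)))

  flow-into : UniformTransitions → ∀ {S x} → x ∉ S →
              ℕtoℚ (suc ∣ S ∣) * flow (S ∪ ⁅ x ⁆) x ≡ weight (S ∪ ⁅ x ⁆)
  flow-into uniform {S} {x} x∉S = subst (λ k → ℕtoℚ k * flow (S ∪ ⁅ x ⁆) x ≡ weight (S ∪ ⁅ x ⁆))
                                        (∣S∪⁅x⁆∣ S x x∉S) (uniform (S ∪ ⁅ x ⁆) x (x∈S∪⁅x⁆ S x))

  weight-step : UniformTransitions → ∀ {S} → ∣ S ∣ ℕ.< n →
    (∀ {x} → x ∉ S → ℕtoℚ (n C suc ∣ S ∣) * weight (S ∪ ⁅ x ⁆) ≡ 1ℚ) →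
    ℕtoℚ (n C ∣ S ∣) * weight S ≡ 1ℚ
  weight-step uniform {S} k<n extensions = ℕtoℚ-*-cancelˡ (ℕP.m<n⇒0<n∸m k<n) (begin
    ℕtoℚ (n ℕ.∸ k) * (ℕtoℚ (n C k) * weight S)  ≡⟨ sym (ℚP.*-assoc (ℕtoℚ (n ℕ.∸ k)) (ℕtoℚ (n C k)) (weight S)) ⟩
    ℕtoℚ (n ℕ.∸ k) * ℕtoℚ (n C k) * weight S    ≡⟨ cong (_* weight S) binomial ⟩
    c * weight S                                ≡⟨ cong (c *_) (weight≡∑-flow-in k<n) ⟩
    c * ∑[ x ∈ allFin n ] (not (lookup S x) ⋆ flow (S ∪ ⁅ x ⁆) x)
      ≡⟨ sym (∑-*ˡ (allFin n) c (λ x → not (lookup S x) ⋆ flow (S ∪ ⁅ x ⁆) x)) ⟩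
    ∑[ x ∈ allFin n ] (c * (not (lookup S x) ⋆ flow (S ∪ ⁅ x ⁆) x))
      ≡⟨ ∑-cong (allFin n) (λ x → trans (*-⋆ (not (lookup S x)) c (flow (S ∪ ⁅ x ⁆) x))
                                  (trans (⋆-cong (not (lookup S x)) (one x))
                                         (cong (_⋆ 1ℚ) (sym (VecP.lookup-map x not S))))) ⟩
    sumOver (∁ S) (λ _ → 1ℚ)                    ≡⟨ trans (sumOver-const (∁ S) 1ℚ) (ℚP.*-identityʳ _) ⟩
    ℕtoℚ ∣ ∁ S ∣                                 ≡⟨ cong ℕtoℚ (SubsetP.∣∁p∣≡n∸∣p∣ S) ⟩
    ℕtoℚ (n ℕ.∸ k)                              ≡⟨ sym (ℚP.*-identityʳ (ℕtoℚ (n ℕ.∸ k))) ⟩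
    ℕtoℚ (n ℕ.∸ k) * 1ℚ                         ∎)
    where
    open ≡-Reasoning
    k = ∣ S ∣
    c = ℕtoℚ (suc k) * ℕtoℚ (n C suc k)
    binomial : ℕtoℚ (n ℕ.∸ k) * ℕtoℚ (n C k) ≡ c
    binomial = trans (sym (ℕtoℚ-* (n ℕ.∸ k) (n C k)))
                     (trans (cong ℕtoℚ ([n∸k]*nCk≡[k+1]*nC[k+1] k<n)) (ℕtoℚ-* (suc k) (n C suc k)))
    one : ∀ x → T (not (lookup S x)) → c * flow (S ∪ ⁅ x ⁆) x ≡ 1ℚ
    one x x∉S? = begin
      c * flow (S ∪ ⁅ x ⁆) x
        ≡⟨ ℚP.*-assoc (ℕtoℚ (suc k)) (ℕtoℚ (n C suc k)) (flow (S ∪ ⁅ x ⁆) x) ⟩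
      ℕtoℚ (suc k) * (ℕtoℚ (n C suc k) * flow (S ∪ ⁅ x ⁆) x)
        ≡⟨ x*[y*z]≡y*[x*z] (ℕtoℚ (suc k)) (ℕtoℚ (n C suc k)) (flow (S ∪ ⁅ x ⁆) x) ⟩
      ℕtoℚ (n C suc k) * (ℕtoℚ (suc k) * flow (S ∪ ⁅ x ⁆) x)
        ≡⟨ cong (ℕtoℚ (n C suc k) *_) (flow-into uniform x∉S) ⟩
      ℕtoℚ (n C suc k) * weight (S ∪ ⁅ x ⁆)                  ≡⟨ extensions x∉S ⟩
      1ℚ                                                     ∎
      where
      x∉S : x ∉ S
      x∉S x∈S = subst T (cong not (VecP.[]=⇒lookup x∈S)) x∉S?

  uniformTransitions⇒weight : UniformTransitions → ∀ S → ℕtoℚ (n C ∣ S ∣) * weight S ≡ 1ℚ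
  uniformTransitions⇒weight uniform = All.wfRec ⊃-wellFounded 0ℓ _ step
    where
    step : ∀ S → (∀ {U} → S ⊂ U → ℕtoℚ (n C ∣ U ∣) * weight U ≡ 1ℚ) → ℕtoℚ (n C ∣ S ∣) * weight S ≡ 1ℚ
    step S above with ∣ S ∣ ℕP.<? n
    ... | yes ∣S∣<n = weight-step uniform ∣S∣<n λ {x} x∉S →
      subst (λ m → ℕtoℚ (n C m) * weight (S ∪ ⁅ x ⁆) ≡ 1ℚ) (∣S∪⁅x⁆∣ S x x∉S) (above (S⊂S∪⁅x⁆ x∉S))
    ... | no  ∣S∣≮n =
      trans (cong₂ (λ m w → ℕtoℚ m * w) (trans (cong (n C_) ∣S∣≡n) (nCn≡1 n)) (weight-full ∣S∣≡n))
            (ℚP.*-identityˡ 1ℚ)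
      where
      ∣S∣≡n : ∣ S ∣ ≡ n
      ∣S∣≡n = ℕP.≤-antisym (SubsetP.∣p∣≤n S) (ℕP.≮⇒≥ ∣S∣≮n)

  uniformTransitions⇒uniformTransitionGraph : UniformTransitions → UniformTransitionGraph D
  uniformTransitions⇒uniformTransitionGraph uniform S _ = uniformTransitions⇒weight uniform S , uniform S

  uniformTransitionGraph⇒uniformTransitions : UniformTransitionGraph D → UniformTransitions
  uniformTransitionGraph⇒uniformTransitions graph S x x∈S = proj₂ (graph S (x , x∈S)) x x∈S

  sumOver-cost-≤ : BalancedFlow → ∀ (c : CostFn n) → Admissible c → ∀ S →
    sumOver S (λ x → c x S * flow S x) ≤ℚ sumOver S (λ x → 1ℚ * flow S x)
  sumOver-cost-≤ balanced c admissible S with SubsetP.nonempty? S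
  ... | no  empty = ℚP.≤-reflexive (∑-cong (allFin n) (λ x → cong (lookup S x ⋆_) (both-zero x)))
    where
    both-zero : ∀ x → c x S * flow S x ≡ 1ℚ * flow S x
    both-zero x = let flow≡0 = flow-∉ (empty ∘ (x ,_)) in
      trans (cong (c x S *_) flow≡0)
            (trans (ℚP.*-zeroʳ (c x S)) (sym (trans (cong (1ℚ *_) flow≡0) (ℚP.*-zeroʳ 1ℚ))))
  ... | yes (x₀ , x₀∈S) = begin
    sumOver S (λ x → c x S * flow S x)
      ≡⟨ ∑-cong (allFin n) (λ x → ⋆-cong (lookup S x) (λ x∈S →
           cong (c x S *_) (balanced S x x₀ (to T-lookup x∈S) x₀∈S))) ⟩
    sumOver S (λ x → c x S * flow S x₀)   ≡⟨ sumOver-*ʳ S (λ x → c x S) (flow S x₀) ⟩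
    sumOver S (λ x → c x S) * flow S x₀   ≤⟨ ℚP.*-monoʳ-≤-nonNeg (flow S x₀) {{ℚ.nonNegative (flow-nonNeg S x₀)}}
                                                                (admissible S (x₀ , x₀∈S)) ⟩
    ℕtoℚ ∣ S ∣ * flow S x₀                ≡⟨ sym (sumOver-constant S (flow S x₀) (λ x x∈S →
                                              trans (ℚP.*-identityˡ (flow S x)) (balanced S x x₀ x∈S x₀∈S))) ⟩
    sumOver S (λ x → 1ℚ * flow S x)       ∎
    where open ℚP.≤-Reasoning

  balancedFlow⇒backwardsEfficient : BalancedFlow → BackwardsEfficient 1ℚ D
  balancedFlow⇒backwardsEfficient balanced c admissible = begin
    Exp D (totalCost c)                                       ≡⟨ Exp-totalCost c ⟩
    ∑[ S ∈ allSubsets n ] sumOver S (λ x → c x S * flow S x)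
      ≤⟨ ∑-mono-≤ (allSubsets n) (sumOver-cost-≤ balanced c admissible) ⟩
    ∑[ S ∈ allSubsets n ] sumOver S (λ x → 1ℚ * flow S x)    ≡⟨ sym (Exp-totalCost unitCost) ⟩
    Exp D (totalCost unitCost)                                ≡⟨ Exp-totalCost-unit ⟩
    ℕtoℚ n                                                    ≡⟨ sym (ℚP.*-identityˡ (ℕtoℚ n)) ⟩
    1ℚ * ℕtoℚ n                                               ∎
    where open ℚP.≤-Reasoning

  Exp-probe : ∀ {Y x} → x ∈ Y →
              Exp D (totalCost (probe Y x)) + weight Y ≡ ℕtoℚ n + ℕtoℚ ∣ Y ∣ * flow Y x
  Exp-probe {Y} {x} x∈Y = begin
    Exp D (totalCost (probe Y x)) + weight Y
      ≡⟨ cong₂ _+_ (trans (Exp-totalCost (probe Y x)) (sym (∑-cong (allSubsets n) (λ Z → ℚP.*-identityˡ _))))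
                   (weight≡sumOver-flow (∈⇒0<∣∣ x∈Y)) ⟩
    ∑[ Z ∈ allSubsets n ] (1ℚ * costAt (probe Y x) Z) + sumOver Y (flow Y)
      ≡⟨ cong (∑[ Z ∈ allSubsets n ] (1ℚ * costAt (probe Y x) Z) +_) (∑-cong (allFin n) (λ z →
           cong (lookup Y z ⋆_) (sym (ℚP.*-identityˡ (flow Y z))))) ⟩
    ∑[ Z ∈ allSubsets n ] (1ℚ * costAt (probe Y x) Z) + costAt unitCost Y
      ≡⟨ sym (∑-agree-below (λ _ → true) tt (costAt unitCost) (costAt (probe Y x)) agree) ⟩
    ∑[ Z ∈ allSubsets n ] (1ℚ * costAt unitCost Z) + costAt (probe Y x) Y
      ≡⟨ cong₂ _+_ (trans (∑-cong (allSubsets n) (λ Z → ℚP.*-identityˡ _))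
                          (trans (sym (Exp-totalCost unitCost)) Exp-totalCost-unit))
                   (trans (∑-cong (allFin n) (λ z → cong (λ c → lookup Y z ⋆ (c * flow Y z)) (probe-at-Y z)))
                          (sumOver-δ x∈Y (ℕtoℚ ∣ Y ∣) (flow Y))) ⟩
    ℕtoℚ n + ℕtoℚ ∣ Y ∣ * flow Y x ∎
    where
    open ≡-Reasoning
    costAt : CostFn n → Subset n → ℚ
    costAt c Z = sumOver Z (λ z → c z Z * flow Z z)
    agree : ∀ Z → T true → Z ≢ Y → costAt unitCost Z ≡ costAt (probe Y x) Z
    agree Z _ Z≢Y rewrite dec-false (Z ≟ₛ Y) Z≢Y = refl
    probe-at-Y : ∀ z → probe Y x z Y ≡ does (z Fin.≟ x) ⋆ ℕtoℚ ∣ Y ∣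
    probe-at-Y z = cong (if_then does (z Fin.≟ x) ⋆ ℕtoℚ ∣ Y ∣ else 1ℚ) (dec-true (Y ≟ₛ Y) refl)

  backwardsEfficient⇒backwardsUniform : BackwardsEfficient 1ℚ D → BackwardsUniform 1ℚ D
  backwardsEfficient⇒backwardsUniform efficient Y _ x x∈Y = +-cancelˡ-≤ (ℕtoℚ n) (begin
    ℕtoℚ n + ℕtoℚ ∣ Y ∣ * flow Y x
      ≡⟨ sym (Exp-probe x∈Y) ⟩
    Exp D (totalCost (probe Y x)) + weight Y
      ≤⟨ ℚP.+-monoˡ-≤ (weight Y) (efficient (probe Y x) (probe-admissible x∈Y)) ⟩
    1ℚ * ℕtoℚ n + weight Y
      ≡⟨ cong₂ _+_ (ℚP.*-identityˡ (ℕtoℚ n)) (sym (ℚP.*-identityˡ (weight Y))) ⟩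
    ℕtoℚ n + 1ℚ * weight Y ∎)
    where open ℚP.≤-Reasoning

  balancedFlow⇒exactMaxwise : BalancedFlow → ExactMaxwise D
  balancedFlow⇒exactMaxwise balanced Y _ x x∈Y =
    trans (sym (sumOver-constant Y (Pr D (lastOf Y x)) same))
          (sumOver-Pr≡1 Y (lastOf Y) (λ π → Prefixes.sumOver-𝟙-lastOf π x∈Y))
    where
    same : ∀ y → y ∈ Y → Pr D (lastOf Y y) ≡ Pr D (lastOf Y x)
    same y y∈Y = trans (Pr-lastOf Y y) (trans (∑-cong (allSubsets n) λ S → 𝟙*-cong (does (Y ⊆? S)) λ t →
                   let Y⊆S = to (T-does (Y ⊆? S)) t in balanced S y x (Y⊆S y∈Y) (Y⊆S x∈Y))
                 (sym (Pr-lastOf Y x)))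

  exactMaxwise⇒balancedFlow : ExactMaxwise D → BalancedFlow
  exactMaxwise⇒balancedFlow maxwise = All.wfRec ⊃-wellFounded 0ℓ _ step
    where
    step : ∀ S → (∀ {U} → S ⊂ U → ∀ x y → x ∈ U → y ∈ U → flow U x ≡ flow U y) →
           ∀ x y → x ∈ S → y ∈ S → flow S x ≡ flow S y
    step S above x y x∈S y∈S = sym (+-cancelˡ (Pr D (lastOf S x)) (flow S y) (flow S x) (begin
      Pr D (lastOf S x) + flow S y
        ≡⟨ cong (_+ flow S y) (Pr-lastOf S x) ⟩
      ∑[ U ∈ allSubsets n ] (𝟙 (does (S ⊆? U)) * flow U x) + flow S y
        ≡⟨ ∑-agree-below (λ U → does (S ⊆? U)) (from (T-does (S ⊆? S)) SubsetP.⊆-refl)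
                         (λ U → flow U x) (λ U → flow U y) agree ⟩
      ∑[ U ∈ allSubsets n ] (𝟙 (does (S ⊆? U)) * flow U y) + flow S x
        ≡⟨ cong (_+ flow S x) (sym (Pr-lastOf S y)) ⟩
      Pr D (lastOf S y) + flow S x
        ≡⟨ cong (_+ flow S x) (trans (last≡1/∣S∣ y∈S) (sym (last≡1/∣S∣ x∈S))) ⟩
      Pr D (lastOf S x) + flow S x ∎))
      where
      open ≡-Reasoning
      last≡1/∣S∣ : ∀ {z} → z ∈ S → Pr D (lastOf S z) ≡ 1/ℕ ∣ S ∣
      last≡1/∣S∣ {z} z∈S = *≡1⇒≡1/ℕ ∣ S ∣ (maxwise S (z , z∈S) z z∈S)
      agree : ∀ U → T (does (S ⊆? U)) → U ≢ S → flow U x ≡ flow U y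
      agree U t U≢S = let S⊆U = to (T-does (S ⊆? U)) t in
        above (⊆∧≢⇒⊂ S⊆U (U≢S ∘ sym)) x y (S⊆U x∈S) (S⊆U y∈S)

  uniformTransitions⇒exactMinwise : UniformTransitions → ExactMinwise D
  uniformTransitions⇒exactMinwise uniform Y _ x x∈Y =
    trans (sym (sumOver-constant Y (Pr D (firstOf Y x)) (λ y y∈Y → trans (first y∈Y) (sym (first x∈Y)))))
          (sumOver-Pr≡1 Y (firstOf Y) (λ π → Prefixes.sumOver-𝟙-firstOf π x∈Y))
    where
    φ : ℕ → ℚ
    φ k = 1/ℕ (k ℕ.* (n C k))
    flow≡φ : ∀ {S z} → z ∈ S → flow S z ≡ φ ∣ S ∣
    flow≡φ {S} {z} z∈S = *≡1⇒≡1/ℕ (∣ S ∣ ℕ.* (n C ∣ S ∣)) (begin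
      ℕtoℚ (∣ S ∣ ℕ.* (n C ∣ S ∣)) * flow S z
        ≡⟨ cong (_* flow S z) (trans (ℕtoℚ-* ∣ S ∣ (n C ∣ S ∣)) (ℚP.*-comm (ℕtoℚ ∣ S ∣) (ℕtoℚ (n C ∣ S ∣)))) ⟩
      ℕtoℚ (n C ∣ S ∣) * ℕtoℚ ∣ S ∣ * flow S z    ≡⟨ ℚP.*-assoc (ℕtoℚ (n C ∣ S ∣)) (ℕtoℚ ∣ S ∣) (flow S z) ⟩
      ℕtoℚ (n C ∣ S ∣) * (ℕtoℚ ∣ S ∣ * flow S z)  ≡⟨ cong (ℕtoℚ (n C ∣ S ∣) *_) (uniform S z z∈S) ⟩
      ℕtoℚ (n C ∣ S ∣) * weight S                 ≡⟨ uniformTransitions⇒weight uniform S ⟩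
      1ℚ                                          ∎)
      where open ≡-Reasoning
    first : ∀ {y} → y ∈ Y → Pr D (firstOf Y y) ≡ sizeSum (n ℕ.∸ ∣ Y ∣) (φ ∘ suc)
    first {y} y∈Y = begin
      Pr D (firstOf Y y)                            ≡⟨ Pr-firstOf Y y ⟩
      ∑-between y (∁ Y ∪ ⁅ y ⁆) (λ S → flow S y)
        ≡⟨ ∑-cong (allSubsets n) (λ S → 𝟙*-cong (does (y ∈? S) ∧ _) λ t →
             flow≡φ (to (T-does (y ∈? S)) (proj₁ (to BoolP.T-∧ t)))) ⟩
      ∑-between y (∁ Y ∪ ⁅ y ⁆) (λ S → φ ∣ S ∣)
        ≡⟨ ∑-between-bySize φ (n ℕ.∸ ∣ Y ∣) (x∈S∪⁅x⁆ (∁ Y) y) (∣∁S∪⁅x⁆∣ y∈Y) ⟩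
      sizeSum (n ℕ.∸ ∣ Y ∣) (φ ∘ suc)               ∎
      where open ≡-Reasoning

  exactMinwise⇒∑-between : ExactMinwise D → ∀ {A a} → a ∈ A →
                           ∑-between a A (λ S → flow S a) ≡ 1/ℕ (suc (n ℕ.∸ ∣ A ∣))
  exactMinwise⇒∑-between minwise {A} {a} a∈A = begin
    ∑-between a A (λ S → flow S a)
      ≡⟨ cong (λ B → ∑-between a B (λ S → flow S a)) (sym (∁S∪⁅x⁆-involutive a∈A)) ⟩
    ∑-between a (∁ Y ∪ ⁅ a ⁆) (λ S → flow S a)  ≡⟨ sym (Pr-firstOf Y a) ⟩
    Pr D (firstOf Y a)                          ≡⟨ *≡1⇒≡1/ℕ ∣ Y ∣ (minwise Y (a , a∈Y) a a∈Y) ⟩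
    1/ℕ ∣ Y ∣                                   ≡⟨ cong 1/ℕ (∣∁S∪⁅x⁆∣ a∈A) ⟩
    1/ℕ (suc (n ℕ.∸ ∣ A ∣))                     ∎
    where
    open ≡-Reasoning
    Y = ∁ A ∪ ⁅ a ⁆
    a∈Y = x∈S∪⁅x⁆ (∁ A) a

  ∑-between-flow-balance : ∀ (ψ : ℕ → ℚ) {B b m} → b ∈ B → ∣ B ∣ ≡ suc m →
    (∀ {S} → ∣ S ∣ ℕ.< ∣ B ∣ → b ∈ S → flow S b ≡ ψ ∣ S ∣) →
    ∑-between b B (λ S → flow S b) + ψ ∣ B ∣ ≡ sizeSum m (ψ ∘ suc) + flow B b
  ∑-between-flow-balance ψ {B} {b} {m} b∈B ∣B∣≡1+m below =
    trans (∑-agree-below (λ S → does (b ∈? S) ∧ does (S ⊆? B))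
                         (from BoolP.T-∧ (from (T-does (b ∈? B)) b∈B , from (T-does (B ⊆? B)) SubsetP.⊆-refl))
                         (λ S → flow S b) (λ S → ψ ∣ S ∣) agree)
          (cong (_+ flow B b) (∑-between-bySize ψ m b∈B ∣B∣≡1+m))
    where
    agree : ∀ S → T (does (b ∈? S) ∧ does (S ⊆? B)) → S ≢ B → flow S b ≡ ψ ∣ S ∣
    agree S t S≢B = let (b∈S , S⊆B) = to BoolP.T-∧ t in
      below (SubsetP.p⊂q⇒∣p∣<∣q∣ (⊆∧≢⇒⊂ (to (T-does (S ⊆? B)) S⊆B) S≢B))
            (to (T-does (b ∈? S)) b∈S)

  exactMinwise⇒flow-bySize : ExactMinwise D → ∀ {S U x y} → x ∈ S → y ∈ U → ∣ S ∣ ≡ ∣ U ∣ →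
                             flow S x ≡ flow U y
  exactMinwise⇒flow-bySize minwise {S} {U} {x} {y} x∈S y∈U ∣S∣≡∣U∣ =
    trans (flow≡ψ S x x∈S) (trans (cong ψ ∣S∣≡∣U∣) (sym (flow≡ψ U y y∈U)))
    where
    first : Fin n
    first = Fin.fromℕ< (ℕP.≤-<-trans ℕ.z≤n (FinP.toℕ<n x))
    -- flow S x will turn out to depend on |S| only; ψ reads it off the sets {0, …, k - 1} ∋ first.
    ψ : ℕ → ℚ
    ψ k = flow (prefixSet k Perm.id) first
    step : ∀ A → (∀ {B} → ∣ B ∣ ℕ.< ∣ A ∣ → ∀ b → b ∈ B → flow B b ≡ ψ ∣ B ∣) →
           ∀ a → a ∈ A → flow A a ≡ ψ ∣ A ∣
    step A below a a∈A = +-cancelˡ (sizeSum m (ψ ∘ suc)) (flow A a) (ψ ∣ A ∣) (begin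
      sizeSum m (ψ ∘ suc) + flow A a
        ≡⟨ sym (∑-between-flow-balance ψ a∈A ∣A∣≡1+m (λ lt → below lt _)) ⟩
      ∑-between a A (λ S → flow S a) + ψ ∣ A ∣
        ≡⟨ cong (_+ ψ ∣ A ∣) same-first ⟩
      ∑-between first R (λ S → flow S first) + ψ ∣ A ∣
        ≡⟨ cong (λ k → ∑-between first R (λ S → flow S first) + ψ k) (sym ∣R∣≡∣A∣) ⟩
      ∑-between first R (λ S → flow S first) + ψ ∣ R ∣
        ≡⟨ ∑-between-flow-balance ψ first∈R (trans ∣R∣≡∣A∣ ∣A∣≡1+m) (λ lt → below (subst (_ ℕ.<_) ∣R∣≡∣A∣ lt) _) ⟩
      sizeSum m (ψ ∘ suc) + ψ ∣ A ∣ ∎)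
      where
      open ≡-Reasoning
      m = ℕ.pred ∣ A ∣
      ∣A∣≡1+m : ∣ A ∣ ≡ suc m
      ∣A∣≡1+m = sym (ℕP.suc-pred ∣ A ∣ {{ℕ.>-nonZero (∈⇒0<∣∣ a∈A)}})
      R = prefixSet ∣ A ∣ Perm.id
      ∣R∣≡∣A∣ : ∣ R ∣ ≡ ∣ A ∣
      ∣R∣≡∣A∣ = Prefixes.∣prefixSet∣ Perm.id (SubsetP.∣p∣≤n A)
      first∈R : first ∈ R
      first∈R = from (Prefixes.∈prefixSet⇔ Perm.id)
                  (subst (ℕ._< ∣ A ∣) (sym (FinP.toℕ-fromℕ< _)) (∈⇒0<∣∣ a∈A))
      same-first : ∑-between a A (λ S → flow S a) ≡ ∑-between first R (λ S → flow S first)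
      same-first = trans (exactMinwise⇒∑-between minwise a∈A)
                         (trans (cong (λ k → 1/ℕ (suc (n ℕ.∸ k))) (sym ∣R∣≡∣A∣))
                                (sym (exactMinwise⇒∑-between minwise first∈R)))
    flow≡ψ : ∀ A a → a ∈ A → flow A a ≡ ψ ∣ A ∣
    flow≡ψ = All.wfRec (On.wellFounded ∣_∣ <-wellFounded) 0ℓ _ step

  exactMinwise⇒balancedFlow : ExactMinwise D → BalancedFlow
  exactMinwise⇒balancedFlow minwise S x y x∈S y∈S = exactMinwise⇒flow-bySize minwise x∈S y∈S refl

proposition1 : (n : ℕ) → 1 ≤ n → (D : Dist n) →
    (BackwardsUniform 1ℚ D ⇔ BackwardsEfficient 1ℚ D)
    × (BackwardsUniform 1ℚ D ⇔ ExactMinwise D)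
    × (BackwardsUniform 1ℚ D ⇔ ExactMaxwise D)
    × (BackwardsUniform 1ℚ D ⇔ UniformTransitionGraph D)
proposition1 n _ D =
    mk⇔ (balancedFlow⇒backwardsEfficient D ∘ balanced) (backwardsEfficient⇒backwardsUniform D)
  , mk⇔ (uniformTransitions⇒exactMinwise D ∘ uniform) (fromBalanced ∘ exactMinwise⇒balancedFlow D)
  , mk⇔ (balancedFlow⇒exactMaxwise D ∘ balanced) (fromBalanced ∘ exactMaxwise⇒balancedFlow D)
  , mk⇔ (uniformTransitions⇒uniformTransitionGraph D ∘ uniform)
        (uniformTransitions⇒backwardsUniform D ∘ uniformTransitionGraph⇒uniformTransitions D)
  where
  uniform : BackwardsUniform 1ℚ D → UniformTransitions D
  uniform = backwardsUniform⇒uniformTransitions D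
  balanced : BackwardsUniform 1ℚ D → BalancedFlow D
  balanced = uniformTransitions⇒balancedFlow D ∘ uniform
  fromBalanced : BalancedFlow D → BackwardsUniform 1ℚ D
  fromBalanced = uniformTransitions⇒backwardsUniform D ∘ balancedFlow⇒uniformTransitions D
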